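{- For all $k,s,n\in\mathbb{N}$ with $2\leq k\leq s$ and $2\binom{s+1}{2}+2s+2\leq n$, there exists a strongly $s$-connected tournament $T$ on $n$ vertices whose diameter is at least $\binom{s+1}{2}^{ -1}(n-2s)$, and such that every strongly $k$-connected subtournament $T'$ of $T$ satisfies $|V(T')|\geq k\binom{s+1}{2}^{ -1}n-k-2$.
   Context: A tournament is a digraph in which every pair of distinct vertices is joined by exactly one directed edge; a subtournament is an induced subgraph of it. A digraph $D$ is strongly $k$-connected if $|V(D)|\geq k+1$ and for every ordered pair $(u,v)$ of vertices and every $S\subseteq V(D)\setminus\{u,v\}$ with $|S|\leq k-1$, there is a directed path from $u$ to $v$ in $D-S$. The diameter of a tournament is the maximum, over ordered pairs $(u,v)$ of vertices, of the length (number of edges) of a shortest directed path from $u$ to $v$. -}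

module Defs where

open import Data.Nat using (ℕ; zero; suc; _≤_; _<_)
open import Data.Bool using (Bool; true; false)
open import Data.Fin using (Fin)
open import Data.Fin.Subset using (Subset; _∈_; _∉_; _⊆_; ∣_∣; ⊤)
open import Data.Product using (Σ; ∃; _×_)
open import Data.Sum using (_⊎_)
open import Relation.Binary.PropositionalEquality using (_≡_; _≢_)
open import Relation.Nullary using (¬_)

-- A digraph on vertex set Fin n, given by its (Boolean) adjacency relation:
-- E u v ≡ true  means there is a directed edge u → v.
Digraph : ℕ → Set
Digraph n = Fin n → Fin n → Bool

record Tournament (n : ℕ) : Set where
  field
    edge      : Digraph n
    loopless  : ∀ u → edge u u ≡ false
    total     : ∀ u v → u ≢ v → edge u v ≡ true ⊎ edge v u ≡ true
    antisym   : ∀ u v → edge u v ≡ true → edge v u ≡ false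
open Tournament public

-- Directed walk from u to v of length l (number of edges) in the subdigraph
-- of E induced on the vertex set A.  (A shortest walk is a path, so walks
-- suffice for reachability and for shortest-path distances.)
data Walk {n : ℕ} (E : Digraph n) (A : Subset n) : Fin n → Fin n → ℕ → Set where
  here : ∀ {u} → u ∈ A → Walk E A u u zero
  step : ∀ {u w v l} → u ∈ A → E u w ≡ true → Walk E A w v l → Walk E A u v (suc l)

open import Data.Fin.Subset using (_─_) public

StronglyConnected : ∀ {n} → Digraph n → Subset n → ℕ → Set
StronglyConnected {n} E A k =
  suc k ≤ ∣ A ∣ ×
  (∀ u v (S : Subset n) → u ∈ A → v ∈ A → S ⊆ A → u ∉ S → v ∉ S → ∣ S ∣ < k →
     ∃ λ l → Walk E (A ─ S) u v l)

TStronglyConnected : ∀ {n} → Tournament n → ℕ → Set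
TStronglyConnected T k = StronglyConnected (edge T) ⊤ k

-- diam(T) ≥ d : some ordered pair (u,v) has shortest-path distance ≥ d,
-- i.e. every directed u→v walk in T has length ≥ d.
DiameterAtLeast : ∀ {n} → Tournament n → ℕ → Set
DiameterAtLeast {n} T d =
  Σ (Fin n) λ u → Σ (Fin n) λ v → ∀ l → Walk (edge T) ⊤ u v l → d ≤ l

-- The vertices are 0, …, n − 1 and K = (s+1 choose 2). Every arc points upwards except the back arcs
-- x → x − (s + (t choose 2)) for 1 ≤ t ≤ s, which are present for t = s (the chains x → x − K), and for
-- t < s only near the ends: when x − (s + (t choose 2)) < t or x + t ≥ n. No arc descends by more than K,
-- so n − 1 ↝ 0 needs at least (n − 1)/K steps.
--
-- After deleting fewer than s vertices, every vertex still reaches a "hub" h ∈ [K, n − K) and every hub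
-- is reached from one: each step pigeonholes s disjoint candidate pairs (w, w − K) against the deleted
-- set and descends along a chain arc. Hubs reach each other by forward arcs and chain descents, and the
-- target side follows by the symmetry x ↦ n − 1 − x, which reverses all arcs.
--
-- If A is strongly k-connected with k ≥ 2, its minimum a and maximum b have two in- resp. out-neighbours
-- in A; as these must be back arcs, which are unique at vertices away from the ends, a ≤ s − 2 and
-- b ≥ n − s. Between a and b every window of K consecutive vertices meets A in at least k vertices,
-- otherwise it would separate b from a.

module Submission where

open import Defs
open import Data.Nat using (ℕ; _≤_; _+_; _*_; _∸_; suc)
open import Data.Nat.Combinatorics using (_C_)
open import Data.Fin.Subset using (Subset; ∣_∣)
open import Data.Product using (Σ; _×_)

open import Data.Nat using (zero; _<_; _≟_; _≤?_; _<?_; z≤n; s≤s; NonZero; >-nonZero)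
open import Data.Nat.Properties
open import Data.Nat.Combinatorics using (nC1≡n; nCk+nC[k+1]≡[n+1]C[k+1]; k>n⇒nCk≡0)
open import Data.Nat.DivMod using (_/_; _%_; m/n*n≤m; m%n<n; m≡m%n+[m/n]*n)
open import Data.Nat.Tactic.RingSolver using (solve-∀)
open import Data.Nat.Induction using (<-rec)
open import Data.Fin as Fin using (Fin; toℕ; fromℕ<; opposite)
open import Data.Fin.Properties using (toℕ-injective; toℕ-fromℕ<; toℕ<n; any?; opposite-prop)
  renaming (suc-injective to Fin-suc-injective)
open import Data.Fin.Subset using (_∈_; _∉_; _⊆_; ⊤; _─_; _∩_; _∪_; _-_; ⁅_⁆) renaming (⊥ to ∅)
open import Data.Fin.Subset.Properties
open import Data.Bool using (Bool; true; false)
open import Data.Vec using ([]; _∷_; lookup; tabulate; _[_]=_; here; there)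
open import Data.Vec.Properties using ([]=⇒lookup; lookup⇒[]=; lookup∘tabulate)
open import Data.Product using (_,_; proj₁; proj₂; ∃; map)
open import Data.Sum using (_⊎_; inj₁; inj₂; [_,_])
open import Data.Empty using (⊥; ⊥-elim)
open import Relation.Nullary using (¬_; Dec; yes; no; does)
open import Relation.Nullary.Decidable using (_×-dec_; _⊎-dec_; ¬?; dec-true; dec-false)
open import Relation.Binary.PropositionalEquality
  using (_≡_; _≢_; refl; sym; trans; cong; cong₂; subst; subst₂; ≢-sym; module ≡-Reasoning)
open import Relation.Binary using (Tri; tri<; tri≈; tri>)
open import Function using (_∘_; case_of_; Injective)

triangle : ℕ → ℕ
triangle zero    = 0
triangle (suc t) = t + triangle t

nC2≡triangle : ∀ m → m C 2 ≡ triangle m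
nC2≡triangle zero    = k>n⇒nCk≡0 {0} {2} (s≤s z≤n)
nC2≡triangle (suc m) = begin
  suc m C 2                 ≡⟨ sym (nCk+nC[k+1]≡[n+1]C[k+1] m 1) ⟩
  m C 1 + m C 2             ≡⟨ cong₂ _+_ (nC1≡n m) (nC2≡triangle m) ⟩
  m + triangle m            ∎
  where open ≡-Reasoning

triangle-mono-≤ : ∀ {a b} → a ≤ b → triangle a ≤ triangle b
triangle-mono-≤ {zero}  _         = z≤n
triangle-mono-≤ {suc a} (s≤s a≤b) = +-mono-≤ a≤b (triangle-mono-≤ a≤b)

triangle-mono-< : ∀ {a b} → 1 ≤ a → a < b → triangle a < triangle b
triangle-mono-< {suc a} _ a<b = ≤-trans (s≤s (m≤n+m (triangle (suc a)) a)) (triangle-mono-≤ a<b)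

triangle-interval-unique : ∀ {t t′ m} →
  triangle t < m → m ≤ triangle (suc t) → triangle t′ < m → m ≤ triangle (suc t′) → t ≡ t′
triangle-interval-unique {t} {t′} lo hi lo′ hi′ with <-cmp t t′
... | tri≈ _ t≡t′ _ = t≡t′
... | tri< t<t′ _ _ = ⊥-elim (n≮n _ (≤-trans lo′ (≤-trans hi (triangle-mono-≤ t<t′))))
... | tri> _ _ t>t′ = ⊥-elim (n≮n _ (≤-trans lo (≤-trans hi′ (triangle-mono-≤ t>t′))))

triangle-double : ∀ m → triangle m + triangle m + m ≡ m * m
triangle-double zero    = refl
triangle-double (suc m) = begin
  (m + triangle m) + (m + triangle m) + suc m   ≡⟨ regroup m (triangle m) ⟩
  (triangle m + triangle m + m) + (m + m + 1)   ≡⟨ cong (_+ (m + m + 1)) (triangle-double m) ⟩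
  m * m + (m + m + 1)                           ≡⟨ square-suc m ⟩
  suc m * suc m                                 ∎
  where
  open ≡-Reasoning
  regroup : ∀ m x → (m + x) + (m + x) + suc m ≡ (x + x + m) + (m + m + 1)
  regroup = solve-∀
  square-suc : ∀ m → m * m + (m + m + 1) ≡ suc m * suc m
  square-suc = solve-∀

ceiling-quotient : ∀ c → 1 ≤ c → ∀ x → ∃ λ d → x ≤ c * d × (∀ l → x ≤ c * l → d ≤ l)
ceiling-quotient c 1≤c zero = 0 , z≤n , λ _ _ → z≤n
ceiling-quotient c 1≤c (suc x) with ceiling-quotient c 1≤c x
... | d , x≤cd , least with suc x ≤? c * d
...   | yes 1+x≤cd = d , 1+x≤cd , λ l 1+x≤cl → least l (≤-trans (n≤1+n x) 1+x≤cl)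
...   | no  1+x≰cd = suc d , 1+x≤c[1+d] , least′
  where
  1+x≤c[1+d] : suc x ≤ c * suc d
  1+x≤c[1+d] = ≤-trans (s≤s x≤cd) (subst (suc (c * d) ≤_) (sym (*-suc c d)) (+-monoˡ-≤ (c * d) 1≤c))
  least′ : ∀ l → suc x ≤ c * l → suc d ≤ l
  least′ l 1+x≤cl with m≤n⇒m<n∨m≡n (least l (≤-trans (n≤1+n x) 1+x≤cl))
  ... | inj₁ d<l  = d<l
  ... | inj₂ refl = ⊥-elim (1+x≰cd 1+x≤cl)

x∈p─q⁻ : ∀ {n} (p q : Subset n) {x} → x ∈ p ─ q → x ∈ p × x ∉ q
x∈p─q⁻ (true ∷ p)  (false ∷ q) here           = here , λ ()
x∈p─q⁻ (false ∷ p) (false ∷ q) {Fin.zero} ()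
x∈p─q⁻ (_ ∷ p)     (true ∷ q)  {Fin.zero} ()
x∈p─q⁻ (_ ∷ p)     (_ ∷ q)     (there x∈p─q) =
  map there (λ x∉q → λ { (there x∈q) → x∉q x∈q }) (x∈p─q⁻ p q x∈p─q)

module _ {n : ℕ} where

  x∈⊤─p⁺ : ∀ {p : Subset n} {x} → x ∉ p → x ∈ ⊤ ─ p
  x∈⊤─p⁺ = x∈p∧x∉q⇒x∈p─q ∈⊤

  x∈⊤─p⁻ : ∀ {p : Subset n} {x} → x ∈ ⊤ ─ p → x ∉ p
  x∈⊤─p⁻ {p} = proj₂ ∘ x∈p─q⁻ ⊤ p

  x∈p⇒⁅x⁆⊆p : ∀ {p : Subset n} {x} → x ∈ p → ⁅ x ⁆ ⊆ p
  x∈p⇒⁅x⁆⊆p {p} {x} x∈p y∈⁅x⁆ = subst (_∈ p) (sym (x∈⁅y⁆⇒x≡y x y∈⁅x⁆)) x∈p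

  ∪-⊆ : ∀ {p q r : Subset n} → p ⊆ r → q ⊆ r → p ∪ q ⊆ r
  ∪-⊆ {p} {q} p⊆r q⊆r x∈p∪q = [ p⊆r , q⊆r ] (x∈p∪q⁻ p q x∈p∪q)

∣p∪q∣≤∣p∣+∣q∣ : ∀ {n} (p q : Subset n) → ∣ p ∪ q ∣ ≤ ∣ p ∣ + ∣ q ∣
∣p∪q∣≤∣p∣+∣q∣ []          []          = z≤n
∣p∪q∣≤∣p∣+∣q∣ (false ∷ p) (false ∷ q) = ∣p∪q∣≤∣p∣+∣q∣ p q
∣p∪q∣≤∣p∣+∣q∣ (true ∷ p)  (false ∷ q) = s≤s (∣p∪q∣≤∣p∣+∣q∣ p q)
∣p∪q∣≤∣p∣+∣q∣ (false ∷ p) (true ∷ q)  =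
  subst (suc ∣ p ∪ q ∣ ≤_) (sym (+-suc ∣ p ∣ ∣ q ∣)) (s≤s (∣p∪q∣≤∣p∣+∣q∣ p q))
∣p∪q∣≤∣p∣+∣q∣ (true ∷ p)  (true ∷ q)  =
  s≤s (≤-trans (∣p∪q∣≤∣p∣+∣q∣ p q) (subst (∣ p ∣ + ∣ q ∣ ≤_) (sym (+-suc ∣ p ∣ ∣ q ∣)) (n≤1+n _)))

∣p∪q∣≡∣p∣+∣q∣ : ∀ {n} (p q : Subset n) → (∀ {x} → x ∈ p → x ∉ q) → ∣ p ∪ q ∣ ≡ ∣ p ∣ + ∣ q ∣
∣p∪q∣≡∣p∣+∣q∣ []          []          _        = refl
∣p∪q∣≡∣p∣+∣q∣ (false ∷ p) (false ∷ q) disjoint = ∣p∪q∣≡∣p∣+∣q∣ p q (λ x∈p x∈q → disjoint (there x∈p) (there x∈q))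
∣p∪q∣≡∣p∣+∣q∣ (true ∷ p)  (false ∷ q) disjoint =
  cong suc (∣p∪q∣≡∣p∣+∣q∣ p q (λ x∈p x∈q → disjoint (there x∈p) (there x∈q)))
∣p∪q∣≡∣p∣+∣q∣ (false ∷ p) (true ∷ q)  disjoint =
  trans (cong suc (∣p∪q∣≡∣p∣+∣q∣ p q (λ x∈p x∈q → disjoint (there x∈p) (there x∈q)))) (sym (+-suc ∣ p ∣ ∣ q ∣))
∣p∪q∣≡∣p∣+∣q∣ (true ∷ p)  (true ∷ q)  disjoint = ⊥-elim (disjoint here here)

∣p∣+∣q∣≤∣r∣ : ∀ {n} {p q r : Subset n} → p ⊆ r → q ⊆ r → (∀ {x} → x ∈ p → x ∉ q) → ∣ p ∣ + ∣ q ∣ ≤ ∣ r ∣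
∣p∣+∣q∣≤∣r∣ {p = p} {q} p⊆r q⊆r disjoint =
  ≤-trans (≤-reflexive (sym (∣p∪q∣≡∣p∣+∣q∣ p q disjoint))) (p⊆q⇒∣p∣≤∣q∣ (∪-⊆ p⊆r q⊆r))

∣p∣+2≤∣r∣ : ∀ {n} {p r : Subset n} {a b} → p ⊆ r → a ∈ r → b ∈ r → a ∉ p → b ∉ p → a ≢ b → ∣ p ∣ + 2 ≤ ∣ r ∣
∣p∣+2≤∣r∣ {p = p} {r} {a} {b} p⊆r a∈r b∈r a∉p b∉p a≢b =
  subst (λ c → ∣ p ∣ + c ≤ ∣ r ∣) ∣⁅a⁆∪⁅b⁆∣≡2 (∣p∣+∣q∣≤∣r∣ p⊆r (∪-⊆ (x∈p⇒⁅x⁆⊆p a∈r) (x∈p⇒⁅x⁆⊆p b∈r)) disjoint)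
  where
  ∣⁅a⁆∪⁅b⁆∣≡2 : ∣ ⁅ a ⁆ ∪ ⁅ b ⁆ ∣ ≡ 2
  ∣⁅a⁆∪⁅b⁆∣≡2 = trans (∣p∪q∣≡∣p∣+∣q∣ ⁅ a ⁆ ⁅ b ⁆ λ x∈⁅a⁆ x∈⁅b⁆ → a≢b (trans (sym (x∈⁅y⁆⇒x≡y a x∈⁅a⁆)) (x∈⁅y⁆⇒x≡y b x∈⁅b⁆)))
                      (cong₂ _+_ (∣⁅x⁆∣≡1 a) (∣⁅x⁆∣≡1 b))
  disjoint : ∀ {x} → x ∈ p → x ∉ ⁅ a ⁆ ∪ ⁅ b ⁆
  disjoint x∈p x∈⁅a⁆∪⁅b⁆ = [ (λ x∈⁅a⁆ → a∉p (subst (_∈ p) (x∈⁅y⁆⇒x≡y a x∈⁅a⁆) x∈p))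
                           , (λ x∈⁅b⁆ → b∉p (subst (_∈ p) (x∈⁅y⁆⇒x≡y b x∈⁅b⁆) x∈p)) ] (x∈p∪q⁻ ⁅ a ⁆ ⁅ b ⁆ x∈⁅a⁆∪⁅b⁆)

injection⇒≤∣p∣ : ∀ {n m} (p : Subset n) (f : Fin m → Fin n) → Injective _≡_ _≡_ f → (∀ i → f i ∈ p) → m ≤ ∣ p ∣
injection⇒≤∣p∣ {m = zero}  p f f-inj f∈p = z≤n
injection⇒≤∣p∣ {m = suc m} p f f-inj f∈p = ≤-trans (s≤s rest) (x∈p⇒∣p-x∣<∣p∣ (f∈p Fin.zero))
  where
  rest : m ≤ ∣ p - f Fin.zero ∣
  rest = injection⇒≤∣p∣ (p - f Fin.zero) (f ∘ Fin.suc) (Fin-suc-injective ∘ f-inj)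
           (λ i → x∈p∧x≢y⇒x∈p-y (f∈p (Fin.suc i)) (λ eq → case f-inj eq of λ ()))

x∈p⇒1≤∣p∣ : ∀ {n} {p : Subset n} {x} → x ∈ p → 1 ≤ ∣ p ∣
x∈p⇒1≤∣p∣ {p = p} {x} x∈p = injection⇒≤∣p∣ p (λ _ → x) (λ { {Fin.zero} {Fin.zero} _ → refl }) (λ _ → x∈p)

minimum : ∀ {n} (p : Subset n) → 1 ≤ ∣ p ∣ → ∃ λ a → a ∈ p × (∀ {y} → y ∈ p → toℕ a ≤ toℕ y)
minimum (true ∷ p)  _ = Fin.zero , here , λ _ → z≤n
minimum (false ∷ p) 1≤∣p∣ with minimum p 1≤∣p∣
... | a , a∈p , least = Fin.suc a , there a∈p , λ { (there y∈p) → s≤s (least y∈p) }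

maximum : ∀ {n} (p : Subset n) → 1 ≤ ∣ p ∣ → ∃ λ b → b ∈ p × (∀ {y} → y ∈ p → toℕ y ≤ toℕ b)
maximum (x ∷ p) 1≤∣x∷p∣ with 1 ≤? ∣ p ∣
... | yes 1≤∣p∣ with maximum p 1≤∣p∣
...   | b , b∈p , greatest = Fin.suc b , there b∈p , λ { here → z≤n ; (there y∈p) → s≤s (greatest y∈p) }
maximum (true ∷ p)  _       | no 1≰∣p∣ =
  Fin.zero , here , λ { here → z≤n ; (there y∈p) → ⊥-elim (1≰∣p∣ (x∈p⇒1≤∣p∣ y∈p)) }
maximum (false ∷ p) 1≤∣p∣   | no 1≰∣p∣ = ⊥-elim (1≰∣p∣ 1≤∣p∣)

∃-avoiding-two : ∀ {n} (p : Subset n) a b → 3 ≤ ∣ p ∣ → ∃ λ u → u ∈ p × u ≢ a × u ≢ b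
∃-avoiding-two p a b 3≤∣p∣ with any? (λ u → (u ∈? p) ×-dec ¬? (u Fin.≟ a) ×-dec ¬? (u Fin.≟ b))
... | yes found = found
... | no none   = ⊥-elim (n≮n 2 (≤-trans 3≤∣p∣ (≤-trans (p⊆q⇒∣p∣≤∣q∣ p⊆⁅a⁆∪⁅b⁆) ∣⁅a⁆∪⁅b⁆∣≤2)))
  where
  p⊆⁅a⁆∪⁅b⁆ : p ⊆ ⁅ a ⁆ ∪ ⁅ b ⁆
  p⊆⁅a⁆∪⁅b⁆ {x} x∈p with x Fin.≟ a | x Fin.≟ b
  ... | yes refl | _        = x∈p∪q⁺ (inj₁ (x∈⁅x⁆ x))
  ... | no  _    | yes refl = x∈p∪q⁺ (inj₂ (x∈⁅x⁆ x))
  ... | no  x≢a  | no  x≢b  = ⊥-elim (none (x , x∈p , x≢a , x≢b))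
  ∣⁅a⁆∪⁅b⁆∣≤2 : ∣ ⁅ a ⁆ ∪ ⁅ b ⁆ ∣ ≤ 2
  ∣⁅a⁆∪⁅b⁆∣≤2 = ≤-trans (∣p∪q∣≤∣p∣+∣q∣ ⁅ a ⁆ ⁅ b ⁆) (≤-reflexive (cong₂ _+_ (∣⁅x⁆∣≡1 a) (∣⁅x⁆∣≡1 b)))

does≡true⇒ : ∀ {P : Set} (P? : Dec P) → does P? ≡ true → P
does≡true⇒ (yes p) _ = p

module _ {n : ℕ} where

  x∈tabulate⁺ : ∀ (f : Fin n → Bool) {x} → f x ≡ true → x ∈ tabulate f
  x∈tabulate⁺ f {x} fx≡true = subst (tabulate f [ x ]=_) fx≡true (lookup⇒[]= x _ (lookup∘tabulate f x))

  x∈tabulate⁻ : ∀ (f : Fin n → Bool) {x} → x ∈ tabulate f → f x ≡ true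
  x∈tabulate⁻ f {x} x∈ = trans (sym (lookup∘tabulate f x)) ([]=⇒lookup x∈)

  interval : ℕ → ℕ → Subset n
  interval lo hi = tabulate λ x → does ((lo <? toℕ x) ×-dec (toℕ x ≤? hi))

  ∈-interval⁺ : ∀ {lo hi x} → lo < toℕ x → toℕ x ≤ hi → x ∈ interval lo hi
  ∈-interval⁺ {lo} {hi} {x} lo<x x≤hi = x∈tabulate⁺ _ (dec-true ((lo <? toℕ x) ×-dec (toℕ x ≤? hi)) (lo<x , x≤hi))

  ∈-interval⁻ : ∀ {lo hi x} → x ∈ interval lo hi → lo < toℕ x × toℕ x ≤ hi
  ∈-interval⁻ {lo} {hi} {x} x∈ = does≡true⇒ ((lo <? toℕ x) ×-dec (toℕ x ≤? hi)) (x∈tabulate⁻ _ x∈)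

module _ {n : ℕ} {E : Digraph n} {A : Subset n} where

  walk-++ : ∀ {u w v l₁ l₂} → Walk E A u w l₁ → Walk E A w v l₂ → Walk E A u v (l₁ + l₂)
  walk-++ (here _)         q = q
  walk-++ (step u∈A uw p) q = step u∈A uw (walk-++ p q)

  walk-source∈ : ∀ {u v l} → Walk E A u v l → u ∈ A
  walk-source∈ (here u∈A)     = u∈A
  walk-source∈ (step u∈A _ _) = u∈A

  walk-first-arc : ∀ {u v l} → Walk E A u v l → u ≢ v → ∃ λ w → w ∈ A × E u w ≡ true
  walk-first-arc (here _)             u≢u = ⊥-elim (u≢u refl)
  walk-first-arc (step {w = w} _ uw p) _  = w , walk-source∈ p , uw

  walk-last-arc : ∀ {u v l} → Walk E A u v l → u ≢ v → ∃ λ w → w ∈ A × E w v ≡ true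
  walk-last-arc (here _) u≢u = ⊥-elim (u≢u refl)
  walk-last-arc {u} {v} (step {w = w} u∈A uw p) _ with w Fin.≟ v
  ... | yes refl = u , u∈A , uw
  ... | no  w≢v  = walk-last-arc p w≢v

  walk-crossing : (P : Fin n → Set) → (∀ x → Dec (P x)) → ∀ {u v l} → Walk E A u v l → P u → ¬ P v →
                  ∃ λ w → ∃ λ w′ → w ∈ A × w′ ∈ A × P w × ¬ P w′ × E w w′ ≡ true
  walk-crossing P P? (here _) Pu ¬Pv = ⊥-elim (¬Pv Pu)
  walk-crossing P P? {u} (step {w = w} u∈A uw p) Pu ¬Pv with P? w
  ... | yes Pw = walk-crossing P P? p Pw ¬Pv
  ... | no ¬Pw = u , w , u∈A , walk-source∈ p , Pu , ¬Pw , uw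

walk-reverse : ∀ {n} {E E′ : Digraph n} {A A′ : Subset n} (g : Fin n → Fin n) →
               (∀ {x} → x ∈ A → g x ∈ A′) → (∀ {x y} → E x y ≡ true → E′ (g y) (g x) ≡ true) →
               ∀ {u v l} → Walk E A u v l → Walk E′ A′ (g v) (g u) l
walk-reverse g g∈ g-arc (here u∈A) = here (g∈ u∈A)
walk-reverse {A′ = A′} g g∈ g-arc {u} (step {l = l} u∈A uw p) =
  subst (Walk _ A′ _ (g u)) (+-comm l 1)
    (walk-++ (walk-reverse g g∈ g-arc p) (step (g∈ (walk-source∈ p)) (g-arc uw) (here (g∈ u∈A))))

-- Matching on the decision with 'with' reduces select d a b, which is not the case for if does d then a else b.
select : ∀ {P B : Set} → Dec P → B → B → B
select (yes _) a _ = a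
select (no _)  _ b = b

module ℕ-Vertices (n : ℕ) (0<n : 0 < n) where

  -- Numbers x ≥ n are sent to vertex 0; the lemmas below only use vertex x for x < n.
  vertex : ℕ → Fin n
  vertex x with x <? n
  ... | yes x<n = fromℕ< x<n
  ... | no  _   = fromℕ< 0<n

  toℕ-vertex : ∀ {x} → x < n → toℕ (vertex x) ≡ x
  toℕ-vertex {x} x<n with x <? n
  ... | yes x<n′ = toℕ-fromℕ< x<n′
  ... | no  x≮n  = ⊥-elim (x≮n x<n)

  vertex-toℕ : ∀ (u : Fin n) → vertex (toℕ u) ≡ u
  vertex-toℕ u = toℕ-injective (toℕ-vertex (toℕ<n u))

  vertex-injective : ∀ {x y} → x < n → y < n → vertex x ≡ vertex y → x ≡ y
  vertex-injective x<n y<n eq = trans (sym (toℕ-vertex x<n)) (trans (cong toℕ eq) (toℕ-vertex y<n))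

  reflect : ℕ → ℕ
  reflect x = n ∸ suc x

  reflect-+ : ∀ {x} → x < n → reflect x + suc x ≡ n
  reflect-+ = m∸n+n≡m

  reflect-< : ∀ {x} → x < n → reflect x < n
  reflect-< {x} x<n = subst (reflect x <_) (reflect-+ x<n) (m<m+n (reflect x) (s≤s z≤n))

  reflect-involutive : ∀ {x} → x < n → reflect (reflect x) ≡ x
  reflect-involutive {x} x<n = begin
    n ∸ suc (reflect x)             ≡⟨ cong (_∸ suc (reflect x)) (sym x+1+rx≡n) ⟩
    x + suc (reflect x) ∸ suc (reflect x) ≡⟨ m+n∸n≡m x (suc (reflect x)) ⟩
    x                               ∎
    where
    open ≡-Reasoning
    x+1+rx≡n : x + suc (reflect x) ≡ n
    x+1+rx≡n = trans (+-suc x (reflect x)) (trans (cong suc (+-comm x (reflect x)))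
                 (trans (sym (+-suc (reflect x) x)) (reflect-+ x<n)))

  reflect-anti : ∀ {a b} → a < b → b < n → reflect b < reflect a
  reflect-anti {a} {b} a<b b<n = +-cancelʳ-< (suc a) (reflect b) (reflect a)
    (≤-trans (+-monoʳ-< (reflect b) (s≤s a<b))
      (≤-reflexive (trans (reflect-+ b<n) (sym (reflect-+ (<-trans a<b b<n))))))

  opposite-vertex : ∀ {x} → x < n → opposite (vertex x) ≡ vertex (reflect x)
  opposite-vertex x<n = toℕ-injective (begin
    toℕ (opposite (vertex _))   ≡⟨ opposite-prop (vertex _) ⟩
    n ∸ suc (toℕ (vertex _))    ≡⟨ cong (λ y → n ∸ suc y) (toℕ-vertex x<n) ⟩
    reflect _                   ≡⟨ sym (toℕ-vertex (reflect-< x<n)) ⟩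
    toℕ (vertex (reflect _))    ∎)
    where open ≡-Reasoning

  reflectSubset : Subset n → Subset n
  reflectSubset p = tabulate (lookup p ∘ opposite)

  ∈-reflectSubset⁺ : ∀ {p i} → opposite i ∈ p → i ∈ reflectSubset p
  ∈-reflectSubset⁺ {p} {i} oi∈p = x∈tabulate⁺ (lookup p ∘ opposite) ([]=⇒lookup oi∈p)

  ∈-reflectSubset⁻ : ∀ {p i} → i ∈ reflectSubset p → opposite i ∈ p
  ∈-reflectSubset⁻ {p} {i} i∈ = lookup⇒[]= (opposite i) p (x∈tabulate⁻ (lookup p ∘ opposite) i∈)

  Bounded : ℕ → (ℕ → ℕ) → Set
  Bounded s f = ∀ i → i < s → f i < n

  InjectiveBelow : ℕ → (ℕ → ℕ) → Set
  InjectiveBelow s f = ∀ i j → i < s → j < s → f i ≡ f j → i ≡ j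

  Sparse : ℕ → Subset n → Set
  Sparse s S = ∀ f → Bounded s f → InjectiveBelow s f → ∃ λ i → i < s × vertex (f i) ∉ S

  small⇒sparse : ∀ {s} (S : Subset n) → ∣ S ∣ < s → Sparse s S
  small⇒sparse {s} S ∣S∣<s f f-bounded f-inj
    with any? (λ (i : Fin s) → ¬? (vertex (f (toℕ i)) ∈? S))
  ... | yes (i , fi∉S) = toℕ i , toℕ<n i , fi∉S
  ... | no  none       = ⊥-elim (n≮n _ (≤-trans ∣S∣<s (injection⇒≤∣p∣ S F F-injective F∈S)))
    where
    F : Fin s → Fin n
    F i = vertex (f (toℕ i))
    F-injective : Injective _≡_ _≡_ F
    F-injective {i} {j} eq = toℕ-injective (f-inj (toℕ i) (toℕ j) (toℕ<n i) (toℕ<n j)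
      (vertex-injective (f-bounded _ (toℕ<n i)) (f-bounded _ (toℕ<n j)) eq))
    F∈S : ∀ i → F i ∈ S
    F∈S i with F i ∈? S
    ... | yes Fi∈S = Fi∈S
    ... | no  Fi∉S = ⊥-elim (none (i , Fi∉S))

  sparse-pair : ∀ {s} {S : Subset n} → Sparse s S → ∀ f g → Bounded s f → Bounded s g →
                InjectiveBelow s f → InjectiveBelow s g → (∀ i j → i < s → j < s → f i ≡ g j → i ≡ j) →
                ∃ λ i → i < s × vertex (f i) ∉ S × vertex (g i) ∉ S
  sparse-pair {s} {S} sparse f g f-bounded g-bounded f-inj g-inj fg-inj with sparse h h-bounded h-inj
    where
    h : ℕ → ℕ
    h i = select (vertex (f i) ∈? S) (f i) (g i)
    h-cases : ∀ i → h i ≡ f i ⊎ h i ≡ g i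
    h-cases i with vertex (f i) ∈? S
    ... | yes _ = inj₁ refl
    ... | no  _ = inj₂ refl
    h-bounded : Bounded s h
    h-bounded i i<s with h-cases i
    ... | inj₁ hi≡fi = subst (_< n) (sym hi≡fi) (f-bounded i i<s)
    ... | inj₂ hi≡gi = subst (_< n) (sym hi≡gi) (g-bounded i i<s)
    h-inj : InjectiveBelow s h
    h-inj i j i<s j<s hi≡hj with h-cases i | h-cases j
    ... | inj₁ eqi | inj₁ eqj = f-inj i j i<s j<s (trans (sym eqi) (trans hi≡hj eqj))
    ... | inj₁ eqi | inj₂ eqj = fg-inj i j i<s j<s (trans (sym eqi) (trans hi≡hj eqj))
    ... | inj₂ eqi | inj₁ eqj = sym (fg-inj j i j<s i<s (trans (sym eqj) (trans (sym hi≡hj) eqi)))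
    ... | inj₂ eqi | inj₂ eqj = g-inj i j i<s j<s (trans (sym eqi) (trans hi≡hj eqj))
  ... | i , i<s , hi∉S with vertex (f i) ∈? S
  ...   | yes fi∈S = ⊥-elim (hi∉S fi∈S)
  ...   | no  fi∉S = i , i<s , fi∉S , hi∉S

  sparse-reflect : ∀ {s} {S : Subset n} → Sparse s S → Sparse s (reflectSubset S)
  sparse-reflect {s} {S} sparse f f-bounded f-inj
    with sparse (reflect ∘ f) (λ i i<s → reflect-< (f-bounded i i<s)) reflect∘f-inj
    where
    reflect∘f-inj : InjectiveBelow s (reflect ∘ f)
    reflect∘f-inj i j i<s j<s eq = f-inj i j i<s j<s (begin
      f i                     ≡⟨ sym (reflect-involutive (f-bounded i i<s)) ⟩
      reflect (reflect (f i)) ≡⟨ cong reflect eq ⟩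
      reflect (reflect (f j)) ≡⟨ reflect-involutive (f-bounded j j<s) ⟩
      f j                     ∎)
      where open ≡-Reasoning
  ... | i , i<s , rfi∉S =
    i , i<s , λ fi∈ → rfi∉S (subst (_∈ S) (opposite-vertex (f-bounded i i<s)) (∈-reflectSubset⁻ fi∈))

module _ {n : ℕ} (T : Tournament n) {A : Subset n} {k : ℕ} (2≤k : 2 ≤ k) (A-conn : StronglyConnected (edge T) A k) where

  private
    3≤∣A∣ : 3 ≤ ∣ A ∣
    3≤∣A∣ = ≤-trans (s≤s 2≤k) (proj₁ A-conn)

    arc⇒≢ : ∀ {x y} → edge T x y ≡ true → x ≢ y
    arc⇒≢ {x} xy refl = case trans (sym xy) (loopless T x) of λ ()

    ∣∅∣<k : ∣ ∅ {n} ∣ < k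
    ∣∅∣<k = subst (_< k) (sym (∣⊥∣≡0 n)) (≤-trans (s≤s z≤n) 2≤k)

    ∣⁅z⁆∣<k : ∀ (z : Fin n) → ∣ ⁅ z ⁆ ∣ < k
    ∣⁅z⁆∣<k z = subst (_< k) (sym (∣⁅x⁆∣≡1 z)) 2≤k

    in-neighbour-outside : ∀ {a u} (S : Subset n) → a ∈ A → u ∈ A → u ≢ a → S ⊆ A → a ∉ S → u ∉ S → ∣ S ∣ < k →
                           ∃ λ w → w ∈ A × w ∉ S × edge T w a ≡ true
    in-neighbour-outside S a∈A u∈A u≢a S⊆A a∉S u∉S ∣S∣<k
      with walk-last-arc (proj₂ (proj₂ A-conn _ _ S u∈A a∈A S⊆A u∉S a∉S ∣S∣<k)) u≢a
    ... | w , w∈A─S , wa = w , proj₁ (x∈p─q⁻ A S w∈A─S) , proj₂ (x∈p─q⁻ A S w∈A─S) , wa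

    out-neighbour-outside : ∀ {a u} (S : Subset n) → a ∈ A → u ∈ A → a ≢ u → S ⊆ A → a ∉ S → u ∉ S → ∣ S ∣ < k →
                            ∃ λ w → w ∈ A × w ∉ S × edge T a w ≡ true
    out-neighbour-outside S a∈A u∈A a≢u S⊆A a∉S u∉S ∣S∣<k
      with walk-first-arc (proj₂ (proj₂ A-conn _ _ S a∈A u∈A S⊆A a∉S u∉S ∣S∣<k)) a≢u
    ... | w , w∈A─S , aw = w , proj₁ (x∈p─q⁻ A S w∈A─S) , proj₂ (x∈p─q⁻ A S w∈A─S) , aw

  two-in-neighbours : ∀ {a} → a ∈ A → ∃ λ x → ∃ λ y → x ∈ A × y ∈ A × edge T x a ≡ true × edge T y a ≡ true × x ≢ y
  two-in-neighbours {a} a∈A with ∃-avoiding-two A a a 3≤∣A∣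
  ... | u , u∈A , u≢a , _ with in-neighbour-outside ∅ a∈A u∈A u≢a ⊥⊆ ∉⊥ ∉⊥ ∣∅∣<k
  ...   | z , z∈A , _ , za with ∃-avoiding-two A a z 3≤∣A∣
  ...     | u′ , u′∈A , u′≢a , u′≢z with in-neighbour-outside ⁅ z ⁆ a∈A u′∈A u′≢a (x∈p⇒⁅x⁆⊆p z∈A)
                                           (x≢y⇒x∉⁅y⁆ (≢-sym (arc⇒≢ za))) (x≢y⇒x∉⁅y⁆ u′≢z) (∣⁅z⁆∣<k z)
  ...       | w , w∈A , w∉⁅z⁆ , wa = z , w , z∈A , w∈A , za , wa , λ z≡w → w∉⁅z⁆ (subst (_∈ ⁅ z ⁆) z≡w (x∈⁅x⁆ z))

  two-out-neighbours : ∀ {a} → a ∈ A → ∃ λ x → ∃ λ y → x ∈ A × y ∈ A × edge T a x ≡ true × edge T a y ≡ true × x ≢ y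
  two-out-neighbours {a} a∈A with ∃-avoiding-two A a a 3≤∣A∣
  ... | u , u∈A , u≢a , _ with out-neighbour-outside ∅ a∈A u∈A (≢-sym u≢a) ⊥⊆ ∉⊥ ∉⊥ ∣∅∣<k
  ...   | z , z∈A , _ , az with ∃-avoiding-two A a z 3≤∣A∣
  ...     | u′ , u′∈A , u′≢a , u′≢z with out-neighbour-outside ⁅ z ⁆ a∈A u′∈A (≢-sym u′≢a) (x∈p⇒⁅x⁆⊆p z∈A)
                                           (x≢y⇒x∉⁅y⁆ (arc⇒≢ az)) (x≢y⇒x∉⁅y⁆ u′≢z) (∣⁅z⁆∣<k z)
  ...       | w , w∈A , w∉⁅z⁆ , aw = z , w , z∈A , w∈A , az , aw , λ z≡w → w∉⁅z⁆ (subst (_∈ ⁅ z ⁆) z≡w (x∈⁅x⁆ z))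

module _ {n : ℕ} {E : Digraph n} (K : ℕ) (drop≤ : ∀ {u v} → E u v ≡ true → toℕ u ≤ toℕ v + K)
         {A : Subset n} {k : ℕ} (A-conn : StronglyConnected E A k) {a b : Fin n} (a∈A : a ∈ A) (b∈A : b ∈ A) where

  -- Otherwise A ∩ (p, p + K] separates b from a: a walk from b down to a has an arc from above p
  -- to at most p, and as arcs drop by at most K, that arc starts in the window.
  window-count : ∀ p → toℕ a ≤ p → p + K < toℕ b → k ≤ ∣ A ∩ interval p (p + K) ∣
  window-count p a≤p p+K<b = ≮⇒≥ λ ∣S∣<k →
    cut (walk-crossing (λ x → p < toℕ x) (λ x → p <? toℕ x)
           (proj₂ (proj₂ A-conn b a S b∈A a∈A (p∩q⊆p A _) b∉S a∉S ∣S∣<k)) p<b (≤⇒≯ a≤p))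
    where
    S = A ∩ interval p (p + K)
    p<b : p < toℕ b
    p<b = ≤-<-trans (m≤m+n p K) p+K<b
    b∉S : b ∉ S
    b∉S b∈S = <⇒≱ p+K<b (proj₂ (∈-interval⁻ (proj₂ (x∈p∩q⁻ A _ b∈S))))
    a∉S : a ∉ S
    a∉S a∈S = <⇒≱ (proj₁ (∈-interval⁻ (proj₂ (x∈p∩q⁻ A _ a∈S)))) a≤p
    cut : (∃ λ w → ∃ λ w′ → w ∈ A ─ S × w′ ∈ A ─ S × p < toℕ w × ¬ p < toℕ w′ × E w w′ ≡ true) → ⊥
    cut (w , w′ , w∈A─S , _ , p<w , p≮w′ , ww′) = proj₂ (x∈p─q⁻ A S w∈A─S)
      (x∈p∩q⁺ (proj₁ (x∈p─q⁻ A S w∈A─S) , ∈-interval⁺ p<w (≤-trans (drop≤ ww′) (+-monoˡ-≤ K (≮⇒≥ p≮w′)))))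

  windows-count : ∀ q m → toℕ a ≤ q → q + m * K < toℕ b → k * m ≤ ∣ A ∩ interval q (q + m * K) ∣
  windows-count q zero    _   _ = ≤-trans (≤-reflexive (*-zeroʳ k)) z≤n
  windows-count q (suc m) a≤q q+[1+m]K<b = begin
    k * suc m                                                      ≡⟨ trans (*-suc k m) (+-comm k (k * m)) ⟩
    k * m + k                                                      ≤⟨ +-mono-≤ (windows-count q m a≤q q+mK<b)
                                                                        (window-count (q + m * K) (≤-trans a≤q (m≤m+n q _)) q+mK+K<b) ⟩
    ∣ A ∩ interval q (q + m * K) ∣ + ∣ A ∩ interval (q + m * K) (q + m * K + K) ∣
                                                                   ≤⟨ ∣p∣+∣q∣≤∣r∣ lower⊆ upper⊆ disjoint ⟩
    ∣ A ∩ interval q (q + suc m * K) ∣                             ∎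
    where
    open ≤-Reasoning
    q+[1+m]K≡ : q + suc m * K ≡ q + m * K + K
    q+[1+m]K≡ = trans (cong (q +_) (+-comm K (m * K))) (sym (+-assoc q (m * K) K))
    q+mK+K<b : q + m * K + K < toℕ b
    q+mK+K<b = subst (_< toℕ b) q+[1+m]K≡ q+[1+m]K<b
    q+mK<b : q + m * K < toℕ b
    q+mK<b = ≤-<-trans (m≤m+n _ K) q+mK+K<b
    lower⊆ : A ∩ interval q (q + m * K) ⊆ A ∩ interval q (q + suc m * K)
    lower⊆ x∈ with x∈p∩q⁻ A _ x∈
    ... | x∈A , x∈I = x∈p∩q⁺ (x∈A , ∈-interval⁺ (proj₁ (∈-interval⁻ x∈I))
                        (≤-trans (proj₂ (∈-interval⁻ x∈I)) (≤-trans (m≤m+n _ K) (≤-reflexive (sym q+[1+m]K≡)))))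
    upper⊆ : A ∩ interval (q + m * K) (q + m * K + K) ⊆ A ∩ interval q (q + suc m * K)
    upper⊆ x∈ with x∈p∩q⁻ A _ x∈
    ... | x∈A , x∈I = x∈p∩q⁺ (x∈A , ∈-interval⁺ (≤-<-trans (m≤m+n q (m * K)) (proj₁ (∈-interval⁻ x∈I)))
                        (≤-trans (proj₂ (∈-interval⁻ x∈I)) (≤-reflexive (sym q+[1+m]K≡))))
    disjoint : ∀ {x} → x ∈ A ∩ interval q (q + m * K) → x ∉ A ∩ interval (q + m * K) (q + m * K + K)
    disjoint x∈lower x∈upper = <⇒≱ (proj₁ (∈-interval⁻ (proj₂ (x∈p∩q⁻ A _ x∈upper))))
                                    (proj₂ (∈-interval⁻ (proj₂ (x∈p∩q⁻ A _ x∈lower))))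

module Construction (s n : ℕ) (2≤s : 2 ≤ s) (n-large : 2 * (s + triangle s) + 2 * s + 2 ≤ n) where

  K : ℕ
  K = s + triangle s

  jump : ℕ → ℕ
  jump t = s + triangle t

  1≤s : 1 ≤ s
  1≤s = ≤-trans (s≤s z≤n) 2≤s

  s<K : s < K
  s<K = subst (_≤ K) (+-comm s 1) (+-monoʳ-≤ s (triangle-mono-≤ 2≤s))

  1≤K : 1 ≤ K
  1≤K = ≤-trans 1≤s (<⇒≤ s<K)

  s≤jump : ∀ t → s ≤ jump t
  s≤jump t = m≤m+n s (triangle t)

  jump≤K : ∀ {t} → t ≤ s → jump t ≤ K
  jump≤K t≤s = +-monoʳ-≤ s (triangle-mono-≤ t≤s)

  +jump≤K : ∀ {t} → t < s → t + jump t ≤ K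
  +jump≤K {t} t<s = begin
    t + (s + triangle t)   ≡⟨ sym (+-assoc t s (triangle t)) ⟩
    t + s + triangle t     ≡⟨ cong (_+ triangle t) (+-comm t s) ⟩
    s + t + triangle t     ≡⟨ +-assoc s t (triangle t) ⟩
    s + triangle (suc t)   ≤⟨ jump≤K t<s ⟩
    K                      ∎
    where open ≤-Reasoning

  jump<K : ∀ {t} → suc t < s → jump (suc t) < K
  jump<K {t} t+1<s = ≤-trans (s≤s (m≤n+m (jump (suc t)) t)) (+jump≤K t+1<s)

  jump-injective : ∀ {t t′} → 1 ≤ t → 1 ≤ t′ → jump t ≡ jump t′ → t ≡ t′
  jump-injective {t} {t′} 1≤t 1≤t′ eq with <-cmp t t′
  ... | tri≈ _ t≡t′ _ = t≡t′
  ... | tri< t<t′ _ _ = ⊥-elim (<-irrefl (+-cancelˡ-≡ s _ _ eq) (triangle-mono-< 1≤t t<t′))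
  ... | tri> _ _ t>t′ = ⊥-elim (<-irrefl (sym (+-cancelˡ-≡ s _ _ eq)) (triangle-mono-< 1≤t′ t>t′))

  n-large′ : K + K + s + s + 2 ≤ n
  n-large′ = subst (_≤ n) (regroup K s) n-large
    where
    regroup : ∀ K s → 2 * K + 2 * s + 2 ≡ K + K + s + s + 2
    regroup = solve-∀

  K+K+s+s<n : K + K + s + s < n
  K+K+s+s<n = ≤-trans (m<m+n (K + K + s + s) (s≤s z≤n)) n-large′

  K+s+K<n : K + s + K < n
  K+s+K<n = ≤-trans (m<m+n (K + s + K) (s≤s z≤n)) (≤-trans (≤-reflexive (regroup K s)) n-large′)
    where
    regroup : ∀ K s → K + s + K + suc (s + 1) ≡ K + K + s + s + 2
    regroup = solve-∀

  -- x → y is a back arc of length jump t: a chain arc (t = s), an arc near the bottom (y < t)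
  -- or an arc near the top (n ≤ x + t).
  BackType : ℕ → ℕ → ℕ → Set
  BackType x y t = 1 ≤ t × x ≡ y + jump t × (t ≡ s ⊎ y < t ⊎ n ≤ x + t)

  Back : ℕ → ℕ → Set
  Back x y = ∃ λ t → t < suc s × BackType x y t

  Back? : ∀ x y → Dec (Back x y)
  Back? x y = anyUpTo? (λ t → (1 ≤? t) ×-dec (x ≟ y + jump t) ×-dec (t ≟ s ⊎-dec y <? t ⊎-dec n ≤? x + t)) (suc s)

  Arc : ℕ → ℕ → Set
  Arc a b = (a < b × ¬ Back b a) ⊎ (b < a × Back a b)

  Arc? : ∀ a b → Dec (Arc a b)
  Arc? a b = (a <? b ×-dec ¬? (Back? b a)) ⊎-dec (b <? a ×-dec Back? a b)

  arc : Digraph n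
  arc u v = does (Arc? (toℕ u) (toℕ v))

  arc⁺ : ∀ {u v} → Arc (toℕ u) (toℕ v) → arc u v ≡ true
  arc⁺ {u} {v} = dec-true (Arc? (toℕ u) (toℕ v))

  arc⁻ : ∀ {u v} → arc u v ≡ true → Arc (toℕ u) (toℕ v)
  arc⁻ {u} {v} = does≡true⇒ (Arc? (toℕ u) (toℕ v))

  Arc-irrefl : ∀ a → ¬ Arc a a
  Arc-irrefl a (inj₁ (a<a , _)) = n≮n a a<a
  Arc-irrefl a (inj₂ (a<a , _)) = n≮n a a<a

  Arc-asym : ∀ a b → Arc a b → ¬ Arc b a
  Arc-asym a b (inj₁ (a<b , _))     (inj₁ (b<a , _))     = <-asym a<b b<a
  Arc-asym a b (inj₁ (_ , ¬back))   (inj₂ (_ , back))    = ¬back back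
  Arc-asym a b (inj₂ (_ , back))    (inj₁ (_ , ¬back))   = ¬back back
  Arc-asym a b (inj₂ (b<a , _))     (inj₂ (a<b , _))     = <-asym a<b b<a

  Arc-total : ∀ a b → a ≢ b → Arc a b ⊎ Arc b a
  Arc-total a b a≢b with <-cmp a b | Back? b a | Back? a b
  ... | tri≈ _ a≡b _ | _         | _         = ⊥-elim (a≢b a≡b)
  ... | tri< a<b _ _ | yes back  | _         = inj₂ (inj₂ (a<b , back))
  ... | tri< a<b _ _ | no  ¬back | _         = inj₁ (inj₁ (a<b , ¬back))
  ... | tri> _ _ b<a | _         | yes back  = inj₁ (inj₂ (b<a , back))
  ... | tri> _ _ b<a | _         | no  ¬back = inj₂ (inj₁ (b<a , ¬back))

  T : Tournament n
  T = record
    { edge     = arc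
    ; loopless = λ u → dec-false (Arc? (toℕ u) (toℕ u)) (Arc-irrefl (toℕ u))
    ; total    = λ u v u≢v → Data.Sum.map arc⁺ arc⁺ (Arc-total (toℕ u) (toℕ v) (u≢v ∘ toℕ-injective))
    ; antisym  = λ u v uv → dec-false (Arc? (toℕ v) (toℕ u)) (Arc-asym (toℕ u) (toℕ v) (arc⁻ uv))
    }

  Back-< : ∀ {x y} → Back x y → y < x
  Back-< {y = y} (t , _ , _ , refl , _) = subst (_≤ y + jump t) (+-comm y 1) (+-monoʳ-≤ y (≤-trans 1≤s (s≤jump t)))

  Back-≤+K : ∀ {x y} → Back x y → x ≤ y + K
  Back-≤+K {y = y} (t , s≤s t≤s , _ , refl , _) = +-monoʳ-≤ y (jump≤K t≤s)

  Back-+s≤ : ∀ {x y} → Back x y → y + s ≤ x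
  Back-+s≤ {y = y} (t , _ , _ , refl , _) = +-monoʳ-≤ y (s≤jump t)

  Arc-≤+K : ∀ {a b} → Arc a b → a ≤ b + K
  Arc-≤+K {b = b} (inj₁ (a<b , _))  = ≤-trans (<⇒≤ a<b) (m≤m+n b K)
  Arc-≤+K         (inj₂ (_ , back)) = Back-≤+K back

  walk-≤+K* : ∀ {A u v l} → Walk arc A u v l → toℕ u ≤ toℕ v + K * l
  walk-≤+K* {l = zero}  (here _) = m≤m+n _ _
  walk-≤+K* {u = u} {v} {suc l} (step {w = w} _ uw p) = begin
    toℕ u                 ≤⟨ Arc-≤+K (arc⁻ uw) ⟩
    toℕ w + K             ≤⟨ +-monoˡ-≤ K (walk-≤+K* p) ⟩
    toℕ v + K * l + K     ≡⟨ +-assoc (toℕ v) (K * l) K ⟩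
    toℕ v + (K * l + K)   ≡⟨ cong (toℕ v +_) (trans (+-comm (K * l) K) (sym (*-suc K l))) ⟩
    toℕ v + K * suc l     ∎
    where open ≤-Reasoning

  0<n : 0 < n
  0<n = ≤-trans (s≤s z≤n) (m+n≤o⇒n≤o (K + K + s + s) n-large′)

  open ℕ-Vertices n 0<n public

  diameter-large : ∃ λ d → DiameterAtLeast T d × n ∸ 2 * s ≤ K * d
  diameter-large with ceiling-quotient K 1≤K (n ∸ 1)
  ... | d , n-1≤Kd , least = d , (vertex (n ∸ 1) , vertex 0 , long) , ≤-trans (∸-monoʳ-≤ n 1≤2s) n-1≤Kd
    where
    long : ∀ l → Walk arc ⊤ (vertex (n ∸ 1)) (vertex 0) l → d ≤ l
    long l p = least l (subst₂ (λ a b → a ≤ b + K * l) (toℕ-vertex (∸-monoʳ-< {n} {1} {0} (s≤s z≤n) 0<n))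
                                (toℕ-vertex 0<n) (walk-≤+K* p))
    1≤2s : 1 ≤ 2 * s
    1≤2s = ≤-trans 1≤s (m≤m+n s (s + 0))

  arc-vertex : ∀ {a b} → a < n → b < n → Arc a b → arc (vertex a) (vertex b) ≡ true
  arc-vertex a<n b<n ab = arc⁺ (subst₂ Arc (sym (toℕ-vertex a<n)) (sym (toℕ-vertex b<n)) ab)

  Back-cases : ∀ {x y} → Back x y → x ≡ y + K ⊎ x < K ⊎ (n ≤ y + K × n < x + s)
  Back-cases {x} {y} (t , s≤s t≤s , _ , x≡y+jt , type) with m≤n⇒m<n∨m≡n t≤s | type
  ... | inj₂ refl | _                  = inj₁ x≡y+jt
  ... | inj₁ t<s  | inj₁ refl          = ⊥-elim (n≮n t t<s)
  ... | inj₁ t<s  | inj₂ (inj₁ y<t)    = inj₂ (inj₁ (begin-strict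
    x            ≡⟨ x≡y+jt ⟩
    y + jump t   <⟨ +-monoˡ-< (jump t) y<t ⟩
    t + jump t   ≤⟨ +jump≤K t<s ⟩
    K            ∎))
    where open ≤-Reasoning
  ... | inj₁ t<s  | inj₂ (inj₂ n≤x+t) = inj₂ (inj₂ (n≤y+K , n<x+s))
    where
    open ≤-Reasoning
    n≤y+K : n ≤ y + K
    n≤y+K = begin
      n                 ≤⟨ n≤x+t ⟩
      x + t             ≡⟨ cong (_+ t) x≡y+jt ⟩
      y + jump t + t    ≡⟨ +-assoc y (jump t) t ⟩
      y + (jump t + t)  ≤⟨ +-monoʳ-≤ y (subst (_≤ K) (+-comm t (jump t)) (+jump≤K t<s)) ⟩
      y + K             ∎
    n<x+s : n < x + s
    n<x+s = ≤-<-trans n≤x+t (+-monoʳ-< x t<s)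

  Arc-chain : ∀ y → Arc (y + K) y
  Arc-chain y = inj₂ (m<m+n y 1≤K , s , ≤-refl , 1≤s , refl , inj₁ refl)

  Arc-short : ∀ {a b} → a < b → b < a + s → Arc a b
  Arc-short a<b b<a+s = inj₁ (a<b , λ back → <⇒≱ b<a+s (Back-+s≤ back))

  -- A hub has room K on both sides, so the only back arcs at it are chain arcs.
  Hub : ℕ → Set
  Hub h = K ≤ h × h + K < n

  Hub⇒< : ∀ {h} → Hub h → h < n
  Hub⇒< (_ , h+K<n) = ≤-trans (s≤s (m≤m+n _ K)) h+K<n

  hub-out : ∀ {h z} → Hub h → z < n → h < z → z ≢ h + K → Arc h z
  hub-out (K≤h , h+K<n) z<n h<z z≢h+K = inj₁ (h<z , λ back → case Back-cases back of λ
    { (inj₁ z≡h+K)              → z≢h+K z≡h+K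
    ; (inj₂ (inj₁ z<K))         → <⇒≱ z<K (≤-trans K≤h (<⇒≤ h<z))
    ; (inj₂ (inj₂ (n≤h+K , _))) → <⇒≱ h+K<n n≤h+K })

  hub-in : ∀ {h z} → Hub h → z < h → z + K ≢ h → Arc z h
  hub-in {h} (K≤h , h+K<n) z<h z+K≢h = inj₁ (z<h , λ back → case Back-cases back of λ
    { (inj₁ h≡z+K)              → z+K≢h (sym h≡z+K)
    ; (inj₂ (inj₁ h<K))         → <⇒≱ h<K K≤h
    ; (inj₂ (inj₂ (_ , n<h+s))) → <⇒≱ n<h+s (≤-trans (+-monoʳ-≤ h (<⇒≤ s<K)) (<⇒≤ h+K<n)) })

  module Avoiding (S : Subset n) (sparse : Sparse s S) where

    Free : ℕ → Set
    Free x = vertex x ∉ S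

    Reach : ℕ → ℕ → Set
    Reach x y = ∃ λ l → Walk arc (⊤ ─ S) (vertex x) (vertex y) l

    reach-refl : ∀ {x} → Free x → Reach x x
    reach-refl x-free = 0 , here (x∈⊤─p⁺ x-free)

    reach-arc : ∀ {x y} → x < n → y < n → Free x → Free y → Arc x y → Reach x y
    reach-arc x<n y<n x-free y-free xy =
      1 , step (x∈⊤─p⁺ x-free) (arc-vertex x<n y<n xy) (here (x∈⊤─p⁺ y-free))

    reach-trans : ∀ {x y z} → Reach x y → Reach y z → Reach x z
    reach-trans (l₁ , p₁) (l₂ , p₂) = l₁ + l₂ , walk-++ p₁ p₂

    record Fan (p : ℕ) (w : ℕ → ℕ) : Set where
      field
        w<n         : ∀ i → suc i < s → w i < n
        K≤w         : ∀ i → suc i < s → K ≤ w i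
        p<w+K       : ∀ i → suc i < s → p < w i + K
        w≢p         : ∀ i → suc i < s → w i ≢ p
        p→w         : ∀ i → suc i < s → Arc p (w i)
        w-injective : ∀ i j → suc i < s → suc j < s → w i ≡ w j → i ≡ j
        w<w+K       : ∀ i j → suc i < s → suc j < s → w i < w j + K

    -- The s pairs (w i, w i ∸ K) for suc i < s and (p ∸ K, p ∸ K) are pairwise disjoint, so S misses one of them.
    fan-free-pair : ∀ {p w} → p < n → K ≤ p → Fan p w → Free (p ∸ K) ⊎ ∃ λ i → suc i < s × Free (w i) × Free (w i ∸ K)
    fan-free-pair {p} {w} p<n K≤p fan = choose (sparse-pair sparse f g f<n g<n f-injective g-injective fg-injective)
      where
      open Fan fan
      p₀ = p ∸ K
      p₀+K≡p : p₀ + K ≡ p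
      p₀+K≡p = m∸n+n≡m K≤p
      p₀<n : p₀ < n
      p₀<n = ≤-<-trans (m∸n≤m p K) p<n
      w∸K+K≡w : ∀ i → suc i < s → w i ∸ K + K ≡ w i
      w∸K+K≡w i i+1<s = m∸n+n≡m (K≤w i i+1<s)
      w∸K<n : ∀ i → suc i < s → w i ∸ K < n
      w∸K<n i i+1<s = ≤-<-trans (m∸n≤m (w i) K) (w<n i i+1<s)
      f g : ℕ → ℕ
      f i = select (suc i <? s) (w i) p₀
      g i = select (suc i <? s) (w i ∸ K) p₀
      family-cases : ∀ i → (suc i < s × f i ≡ w i × g i ≡ w i ∸ K) ⊎ (¬ suc i < s × f i ≡ p₀ × g i ≡ p₀)
      family-cases i with suc i <? s
      ... | yes i+1<s = inj₁ (i+1<s , refl , refl)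
      ... | no  i+1≮s = inj₂ (i+1≮s , refl , refl)
      last-unique : ∀ {i j} → i < s → j < s → ¬ suc i < s → ¬ suc j < s → i ≡ j
      last-unique i<s j<s i+1≮s j+1≮s =
        suc-injective (trans (≤-antisym i<s (≮⇒≥ i+1≮s)) (sym (≤-antisym j<s (≮⇒≥ j+1≮s))))
      w≢p₀ : ∀ i → suc i < s → w i ≢ p₀
      w≢p₀ i i+1<s eq = n≮n p (≤-trans (p<w+K i i+1<s) (≤-reflexive (trans (cong (_+ K) eq) p₀+K≡p)))
      w∸K≢p₀ : ∀ i → suc i < s → w i ∸ K ≢ p₀
      w∸K≢p₀ i i+1<s eq = w≢p i i+1<s (trans (sym (w∸K+K≡w i i+1<s)) (trans (cong (_+ K) eq) p₀+K≡p))
      f<n : Bounded s f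
      f<n i _ with family-cases i
      ... | inj₁ (i+1<s , eq , _) = subst (_< n) (sym eq) (w<n i i+1<s)
      ... | inj₂ (_ , eq , _)     = subst (_< n) (sym eq) p₀<n
      g<n : Bounded s g
      g<n i _ with family-cases i
      ... | inj₁ (i+1<s , _ , eq) = subst (_< n) (sym eq) (w∸K<n i i+1<s)
      ... | inj₂ (_ , _ , eq)     = subst (_< n) (sym eq) p₀<n
      f-injective : InjectiveBelow s f
      f-injective i j i<s j<s eq with family-cases i | family-cases j
      ... | inj₁ (i′ , ei , _) | inj₁ (j′ , ej , _) = w-injective i j i′ j′ (trans (sym ei) (trans eq ej))
      ... | inj₁ (i′ , ei , _) | inj₂ (_ , ej , _)  = ⊥-elim (w≢p₀ i i′ (trans (sym ei) (trans eq ej)))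
      ... | inj₂ (_ , ei , _)  | inj₁ (j′ , ej , _) = ⊥-elim (w≢p₀ j j′ (trans (sym ej) (trans (sym eq) ei)))
      ... | inj₂ (i′ , _ , _)  | inj₂ (j′ , _ , _)  = last-unique i<s j<s i′ j′
      g-injective : InjectiveBelow s g
      g-injective i j i<s j<s eq with family-cases i | family-cases j
      ... | inj₁ (i′ , _ , ei) | inj₁ (j′ , _ , ej) = w-injective i j i′ j′
              (trans (sym (w∸K+K≡w i i′)) (trans (cong (_+ K) (trans (sym ei) (trans eq ej))) (w∸K+K≡w j j′)))
      ... | inj₁ (i′ , _ , ei) | inj₂ (_ , _ , ej)  = ⊥-elim (w∸K≢p₀ i i′ (trans (sym ei) (trans eq ej)))
      ... | inj₂ (_ , _ , ei)  | inj₁ (j′ , _ , ej) = ⊥-elim (w∸K≢p₀ j j′ (trans (sym ej) (trans (sym eq) ei)))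
      ... | inj₂ (i′ , _ , _)  | inj₂ (j′ , _ , _)  = last-unique i<s j<s i′ j′
      fg-injective : ∀ i j → i < s → j < s → f i ≡ g j → i ≡ j
      fg-injective i j i<s j<s eq with family-cases i | family-cases j
      ... | inj₁ (i′ , ei , _) | inj₁ (j′ , _ , ej) = ⊥-elim (n≮n _ (≤-trans (w<w+K j i j′ i′)
              (≤-reflexive (trans (cong (_+ K) (trans (sym ei) (trans eq ej))) (w∸K+K≡w j j′)))))
      ... | inj₁ (i′ , ei , _) | inj₂ (_ , _ , ej)  = ⊥-elim (w≢p₀ i i′ (trans (sym ei) (trans eq ej)))
      ... | inj₂ (_ , ei , _)  | inj₁ (j′ , _ , ej) = ⊥-elim (w∸K≢p₀ j j′ (trans (sym ej) (trans (sym eq) ei)))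
      ... | inj₂ (i′ , _ , _)  | inj₂ (j′ , _ , _)  = last-unique i<s j<s i′ j′
      choose : (∃ λ i → i < s × Free (f i) × Free (g i)) → Free p₀ ⊎ ∃ λ i → suc i < s × Free (w i) × Free (w i ∸ K)
      choose (i , _ , fi-free , gi-free) = [ pair-w , pair-p₀ ] (family-cases i)
        where
        pair-w : suc i < s × f i ≡ w i × g i ≡ w i ∸ K → _
        pair-w (i+1<s , fi≡wi , gi≡wi∸K) = inj₂ (i , i+1<s , subst Free fi≡wi fi-free , subst Free gi≡wi∸K gi-free)
        pair-p₀ : ¬ suc i < s × f i ≡ p₀ × g i ≡ p₀ → _
        pair-p₀ (_ , _ , gi≡p₀) = inj₁ (subst Free gi≡p₀ gi-free)

    Descent : ℕ → (ℕ → ℕ) → Set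
    Descent p w = ∃ λ q → Free q × q < n × (q + K ≡ p ⊎ ∃ λ i → suc i < s × q + K ≡ w i) × Reach p q

    fan-descent : ∀ {p w} → p < n → K ≤ p → Free p → Fan p w → Descent p w
    fan-descent {p} {w} p<n K≤p p-free fan = [ via-p∸K , via-w ] (fan-free-pair p<n K≤p fan)
      where
      open Fan fan
      via-p∸K : Free (p ∸ K) → Descent p w
      via-p∸K p∸K-free = p ∸ K , p∸K-free , p∸K<n , inj₁ p∸K+K≡p ,
        reach-arc p<n p∸K<n p-free p∸K-free (subst (λ x → Arc x (p ∸ K)) p∸K+K≡p (Arc-chain (p ∸ K)))
        where
        p∸K+K≡p = m∸n+n≡m K≤p
        p∸K<n = ≤-<-trans (m∸n≤m p K) p<n
      via-w : (∃ λ i → suc i < s × Free (w i) × Free (w i ∸ K)) → Descent p w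
      via-w (i , i+1<s , wi-free , wi∸K-free) = w i ∸ K , wi∸K-free , wi∸K<n , inj₂ (i , i+1<s , wi∸K+K≡wi) ,
        reach-trans (reach-arc p<n (w<n i i+1<s) p-free wi-free (p→w i i+1<s))
                    (reach-arc (w<n i i+1<s) wi∸K<n wi-free wi∸K-free
                      (subst (λ x → Arc x (w i ∸ K)) wi∸K+K≡wi (Arc-chain (w i ∸ K))))
        where
        wi∸K+K≡wi = m∸n+n≡m (K≤w i i+1<s)
        wi∸K<n = ≤-<-trans (m∸n≤m (w i) K) (w<n i i+1<s)

    ReachesHub : ℕ → Set
    ReachesHub u = ∃ λ h → Hub h × Free h × Reach u h

    reach-chain : ∀ {h} → Hub h → Hub (h + K) → Free h → Free (h + K) → Reach h (h + K)
    reach-chain {h} H H′ h-free h′-free =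
      via (sparse (λ i → h + suc i) (λ i i<s → h+1+i<n i<s) (λ i j _ _ eq → suc-injective (+-cancelˡ-≡ h _ _ eq)))
      where
      h+1+i<h+K : ∀ {i} → i < s → h + suc i < h + K
      h+1+i<h+K i<s = +-monoʳ-< h (≤-<-trans i<s s<K)
      h+1+i<n : ∀ {i} → i < s → h + suc i < n
      h+1+i<n i<s = <-trans (h+1+i<h+K i<s) (proj₂ H)
      via : (∃ λ i → i < s × Free (h + suc i)) → Reach h (h + K)
      via (i , i<s , w-free) =
        reach-trans (reach-arc (Hub⇒< H) (h+1+i<n i<s) h-free w-free
                      (hub-out H (h+1+i<n i<s) (m<m+n h (s≤s z≤n)) (<⇒≢ (h+1+i<h+K i<s))))
                    (reach-arc (h+1+i<n i<s) (Hub⇒< H′) w-free h′-free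
                      (hub-in H′ (h+1+i<h+K i<s) (>⇒≢ (+-monoˡ-< K (m<m+n h (s≤s z≤n))))))

    reach-up : ∀ {h h′} → Hub h → Hub h′ → Free h → Free h′ → h < h′ → Reach h h′
    reach-up {h} {h′} H H′ h-free h′-free h<h′ = by-cases (h′ ≟ h + K)
      where
      by-cases : Dec (h′ ≡ h + K) → Reach h h′
      by-cases (no  h′≢h+K) = reach-arc (Hub⇒< H) (Hub⇒< H′) h-free h′-free (hub-out H (Hub⇒< H′) h<h′ h′≢h+K)
      by-cases (yes h′≡h+K) = subst (Reach h) (sym h′≡h+K)
        (reach-chain H (subst Hub h′≡h+K H′) h-free (subst Free h′≡h+K h′-free))

    reach-down : ∀ {h′} → Hub h′ → Free h′ → ∀ p → Hub p → Free p → h′ < p → Reach p h′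
    reach-down {h′} H′ h′-free = <-rec (λ p → Hub p → Free p → h′ < p → Reach p h′) descend-from
      where
      descend-from : ∀ p → (∀ {q} → q < p → Hub q → Free q → h′ < q → Reach q h′) →
                     Hub p → Free p → h′ < p → Reach p h′
      descend-from p IH H p-free h′<p = continue (fan-descent (Hub⇒< H) (proj₁ H) p-free fan)
        where
        w : ℕ → ℕ
        w i = p + suc i
        w<p+K : ∀ {i} → suc i < s → w i < p + K
        w<p+K i+1<s = +-monoʳ-< p (<-trans i+1<s s<K)
        fan : Fan p w
        fan = record
          { w<n         = λ i i+1<s → <-trans (w<p+K i+1<s) (proj₂ H)
          ; K≤w         = λ i _ → ≤-trans (proj₁ H) (m≤m+n p (suc i))
          ; p<w+K       = λ i _ → ≤-trans (m<m+n p (s≤s z≤n)) (m≤m+n _ K)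
          ; w≢p         = λ i _ → >⇒≢ (m<m+n p (s≤s z≤n))
          ; p→w         = λ i i+1<s → Arc-short (m<m+n p (s≤s z≤n)) (+-monoʳ-< p i+1<s)
          ; w-injective = λ i j _ _ eq → suc-injective (+-cancelˡ-≡ p _ _ eq)
          ; w<w+K       = λ i j i+1<s _ → ≤-trans (w<p+K i+1<s) (+-monoˡ-≤ K (m≤m+n p (suc j)))
          }
        landing : ∀ {q} → (q + K ≡ p ⊎ ∃ λ i → suc i < s × q + K ≡ w i) → q < p × p ≤ q + K × q + K < n
        landing {q} (inj₁ q+K≡p) =
          +-cancelʳ-< K q p (subst (_< p + K) (sym q+K≡p) (m<m+n p 1≤K)) , ≤-reflexive (sym q+K≡p) ,
          subst (_< n) (sym q+K≡p) (Hub⇒< H)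
        landing {q} (inj₂ (i , i+1<s , q+K≡w)) =
          +-cancelʳ-< K q p (subst (_< p + K) (sym q+K≡w) (w<p+K i+1<s)) , ≤-trans (m≤m+n p (suc i)) (≤-reflexive (sym q+K≡w)) ,
          subst (_< n) (sym q+K≡w) (Fan.w<n fan i i+1<s)
        continue : Descent p w → Reach p h′
        continue (q , q-free , q<n , q+K , p⇝q) = by-order (<-cmp q h′)
          where
          by-order : Tri (q < h′) (q ≡ h′) (h′ < q) → Reach p h′
          by-order (tri< q<h′ _ _) = reach-trans p⇝q (reach-arc q<n (Hub⇒< H′) q-free h′-free
            (hub-in H′ q<h′ (λ q+K≡h′ → <⇒≱ h′<p (subst (p ≤_) q+K≡h′ (proj₁ (proj₂ (landing {q} q+K)))))))
          by-order (tri≈ _ q≡h′ _) = subst (Reach p) q≡h′ p⇝q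
          by-order (tri> _ _ h′<q) = reach-trans p⇝q
            (IH (proj₁ (landing {q} q+K)) (≤-trans (proj₁ H′) (<⇒≤ h′<q) , proj₂ (proj₂ (landing {q} q+K))) q-free h′<q)

    hub-reach : ∀ {h h′} → Hub h → Hub h′ → Free h → Free h′ → Reach h h′
    hub-reach {h} {h′} H H′ h-free h′-free = by-order (<-cmp h h′)
      where
      by-order : Tri (h < h′) (h ≡ h′) (h′ < h) → Reach h h′
      by-order (tri< h<h′ _ _) = reach-up H H′ h-free h′-free h<h′
      by-order (tri≈ _ h≡h′ _) = subst (Reach h) h≡h′ (reach-refl h-free)
      by-order (tri> _ _ h′<h) = reach-down H′ h′-free h H h-free h′<h

    skip : ℕ → ℕ → ℕ
    skip u i = select (i <? u) i (suc i)

    low-reach-hub : ∀ {u} → u < K → Free u → ReachesHub u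
    low-reach-hub {u} u<K u-free =
      via (sparse (λ i → K + skip u i) (λ i i<s → Hub⇒< (hub i<s)) (λ i j _ _ eq → skip-injective (+-cancelˡ-≡ K _ _ eq)))
      where
      skip-cases : ∀ i → (i < u × skip u i ≡ i) ⊎ (¬ i < u × skip u i ≡ suc i)
      skip-cases i with i <? u
      ... | yes i<u = inj₁ (i<u , refl)
      ... | no  i≮u = inj₂ (i≮u , refl)
      skip≤ : ∀ i → skip u i ≤ suc i
      skip≤ i with skip-cases i
      ... | inj₁ (_ , eq) = ≤-trans (≤-reflexive eq) (n≤1+n i)
      ... | inj₂ (_ , eq) = ≤-reflexive eq
      skip≢ : ∀ i → skip u i ≢ u
      skip≢ i eq with skip-cases i
      ... | inj₁ (i<u , eq′) = <-irrefl (trans (sym eq′) eq) i<u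
      ... | inj₂ (i≮u , eq′) = i≮u (≤-reflexive (trans (sym eq′) eq))
      skip-injective : ∀ {i j} → skip u i ≡ skip u j → i ≡ j
      skip-injective {i} {j} eq with skip-cases i | skip-cases j
      ... | inj₁ (_ , ei)   | inj₁ (_ , ej)   = trans (sym ei) (trans eq ej)
      ... | inj₁ (i<u , ei) | inj₂ (j≮u , ej) = ⊥-elim (j≮u (≤-trans (≤-reflexive (sym (trans (sym ei) (trans eq ej)))) (<⇒≤ i<u)))
      ... | inj₂ (i≮u , ei) | inj₁ (j<u , ej) = ⊥-elim (i≮u (≤-trans (≤-reflexive (trans (sym ei) (trans eq ej))) (<⇒≤ j<u)))
      ... | inj₂ (_ , ei)   | inj₂ (_ , ej)   = suc-injective (trans (sym ei) (trans eq ej))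
      hub : ∀ {i} → i < s → Hub (K + skip u i)
      hub {i} i<s = m≤m+n K _ , ≤-<-trans (+-monoˡ-≤ K (+-monoʳ-≤ K (≤-trans (skip≤ i) i<s))) K+s+K<n
      u<n : u < n
      u<n = <-trans u<K (≤-<-trans (m≤m+n K s) (≤-<-trans (m≤m+n (K + s) K) K+s+K<n))
      via : (∃ λ i → i < s × Free (K + skip u i)) → ReachesHub u
      via (i , i<s , h-free) = K + skip u i , hub i<s , h-free ,
        reach-arc u<n (Hub⇒< (hub i<s)) u-free h-free
          (hub-in (hub i<s) (≤-trans u<K (m≤m+n K _)) (λ eq → skip≢ i (sym (+-cancelˡ-≡ K _ _ (trans (+-comm K u) eq)))))

    -- Near the top the vertex u has few vertices above it; the missing out-neighbours are supplied
    -- by the back arcs u → u ∸ jump t, which exist because u is within t of the top.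
    high-reach-lower : ∀ {u} → u < n → n ≤ u + K → Free u → ∃ λ q → q + K < n × Free q × Reach u q
    high-reach-lower {u} u<n n≤u+K u-free = lower (fan-descent u<n K≤u u-free fan)
      where
      open ≤-Reasoning
      e = n ∸ suc u
      u+1+e≡n : u + suc e ≡ n
      u+1+e≡n = trans (+-comm u (suc e)) (trans (sym (+-suc e u)) (m∸n+n≡m u<n))
      K≤u : K ≤ u
      K≤u = +-cancelʳ-≤ K K u (≤-trans (≤-trans (m≤m+n (K + K) s) (m≤m+n _ s)) (≤-trans (<⇒≤ K+K+s+s<n) n≤u+K))
      near-top : ∀ {i} → ¬ i < e → n ≤ u + suc i
      near-top i≮e = subst (_≤ u + suc _) u+1+e≡n (+-monoʳ-≤ u (s≤s (≮⇒≥ i≮e)))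
      u∸jump+jump≡u : ∀ {i} → suc i < s → u ∸ jump (suc i) + jump (suc i) ≡ u
      u∸jump+jump≡u i+1<s = m∸n+n≡m (≤-trans (<⇒≤ (jump<K i+1<s)) K≤u)
      u∸jump<u : ∀ {i} → suc i < s → u ∸ jump (suc i) < u
      u∸jump<u {i} i+1<s = subst (u ∸ jump (suc i) <_) (u∸jump+jump≡u i+1<s)
        (m<m+n (u ∸ jump (suc i)) (≤-trans (s≤s z≤n) (≤-trans 1≤s (s≤jump (suc i)))))
      K+jump≤u : ∀ {i} → suc i < s → ¬ i < e → K + jump (suc i) ≤ u
      K+jump≤u {i} i+1<s i≮e = +-cancelʳ-≤ s _ u (begin
        K + jump (suc i) + s   ≤⟨ +-monoˡ-≤ s (+-monoʳ-≤ K (<⇒≤ (jump<K i+1<s))) ⟩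
        K + K + s              ≤⟨ m≤m+n _ s ⟩
        K + K + s + s          ≤⟨ <⇒≤ K+K+s+s<n ⟩
        n                      ≤⟨ near-top i≮e ⟩
        u + suc i              ≤⟨ +-monoʳ-≤ u (<⇒≤ i+1<s) ⟩
        u + s                  ∎)
      w : ℕ → ℕ
      w i = select (i <? e) (u + suc i) (u ∸ jump (suc i))
      w-cases : ∀ i → (i < e × w i ≡ u + suc i) ⊎ (¬ i < e × w i ≡ u ∸ jump (suc i))
      w-cases i with i <? e
      ... | yes i<e = inj₁ (i<e , refl)
      ... | no  i≮e = inj₂ (i≮e , refl)
      fan : Fan u w
      fan = record
        { w<n         = w<n
        ; K≤w         = K≤w
        ; p<w+K       = u<w+K
        ; w≢p         = w≢u
        ; p→w         = u→w
        ; w-injective = w-injective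
        ; w<w+K       = w<w+K
        }
        where
        w<n : ∀ i → suc i < s → w i < n
        w<n i _ with w-cases i
        ... | inj₁ (i<e , eq) = subst (_< n) (sym eq) (subst (u + suc i <_) u+1+e≡n (+-monoʳ-< u (s≤s i<e)))
        ... | inj₂ (_ , eq)   = subst (_< n) (sym eq) (≤-<-trans (m∸n≤m u (jump (suc i))) u<n)
        K≤w : ∀ i → suc i < s → K ≤ w i
        K≤w i i+1<s with w-cases i
        ... | inj₁ (_ , eq)   = subst (K ≤_) (sym eq) (≤-trans K≤u (m≤m+n u (suc i)))
        ... | inj₂ (i≮e , eq) = subst (K ≤_) (sym eq) (m+n≤o⇒m≤o∸n K (K+jump≤u i+1<s i≮e))
        u<w+K : ∀ i → suc i < s → u < w i + K
        u<w+K i i+1<s with w-cases i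
        ... | inj₁ (_ , eq) = subst (λ x → u < x + K) (sym eq) (≤-trans (m<m+n u (s≤s z≤n)) (m≤m+n _ K))
        ... | inj₂ (_ , eq) = subst (λ x → u < x + K) (sym eq)
                (subst (_< u ∸ jump (suc i) + K) (u∸jump+jump≡u i+1<s) (+-monoʳ-< (u ∸ jump (suc i)) (jump<K i+1<s)))
        w≢u : ∀ i → suc i < s → w i ≢ u
        w≢u i i+1<s with w-cases i
        ... | inj₁ (_ , eq) = λ wi≡u → >⇒≢ (m<m+n u (s≤s z≤n)) (trans (sym eq) wi≡u)
        ... | inj₂ (_ , eq) = λ wi≡u → <⇒≢ (u∸jump<u i+1<s) (trans (sym eq) wi≡u)
        u→w : ∀ i → suc i < s → Arc u (w i)
        u→w i i+1<s with w-cases i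
        ... | inj₁ (_ , eq)   = subst (Arc u) (sym eq) (Arc-short (m<m+n u (s≤s z≤n)) (+-monoʳ-< u i+1<s))
        ... | inj₂ (i≮e , eq) = subst (Arc u) (sym eq) (inj₂ (u∸jump<u i+1<s ,
                suc i , m≤n⇒m≤1+n i+1<s , s≤s z≤n , sym (u∸jump+jump≡u i+1<s) , inj₂ (inj₂ (near-top i≮e))))
        w-injective : ∀ i j → suc i < s → suc j < s → w i ≡ w j → i ≡ j
        w-injective i j i+1<s j+1<s eq with w-cases i | w-cases j
        ... | inj₁ (_ , ei) | inj₁ (_ , ej) = suc-injective (+-cancelˡ-≡ u _ _ (trans (sym ei) (trans eq ej)))
        ... | inj₁ (_ , ei) | inj₂ (_ , ej) = ⊥-elim (<-asym (m<m+n u (s≤s z≤n))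
                (subst (_< u) (trans (sym ej) (trans (sym eq) ei)) (u∸jump<u j+1<s)))
        ... | inj₂ (_ , ei) | inj₁ (_ , ej) = ⊥-elim (<-asym (m<m+n u (s≤s z≤n))
                (subst (_< u) (trans (sym ei) (trans eq ej)) (u∸jump<u i+1<s)))
        ... | inj₂ (_ , ei) | inj₂ (_ , ej) = suc-injective (jump-injective (s≤s z≤n) (s≤s z≤n)
                (+-cancelˡ-≡ (u ∸ jump (suc i)) _ _ (trans (u∸jump+jump≡u i+1<s) (trans (sym (u∸jump+jump≡u j+1<s))
                  (cong (_+ jump (suc j)) (trans (sym ej) (trans (sym eq) ei)))))))
        w<w+K : ∀ i j → suc i < s → suc j < s → w i < w j + K
        w<w+K i j i+1<s j+1<s with w-cases i | w-cases j
        ... | inj₂ (_ , ei)   | _               = ≤-<-trans (≤-reflexive ei) (≤-<-trans (m∸n≤m u (jump (suc i))) (u<w+K j j+1<s))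
        ... | inj₁ (_ , ei)   | inj₁ (_ , ej)   = subst₂ (λ a b → a < b + K) (sym ei) (sym ej)
                (≤-trans (+-monoʳ-< u (<-trans i+1<s s<K)) (+-monoˡ-≤ K (m≤m+n u (suc j))))
        ... | inj₁ (i<e , ei) | inj₂ (j≮e , ej) = subst₂ (λ a b → a < b + K) (sym ei) (sym ej) (begin-strict
          u + suc i                                   ≡⟨ cong (_+ suc i) (sym (u∸jump+jump≡u j+1<s)) ⟩
          u ∸ jump (suc j) + jump (suc j) + suc i     ≡⟨ +-assoc (u ∸ jump (suc j)) _ (suc i) ⟩
          u ∸ jump (suc j) + (jump (suc j) + suc i)   <⟨ +-monoʳ-< (u ∸ jump (suc j)) jump+i+1<K ⟩
          u ∸ jump (suc j) + K                        ∎)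
          where
          jump+i+1<K : jump (suc j) + suc i < K
          jump+i+1<K = ≤-trans (+-monoʳ-< (jump (suc j)) (s≤s (≤-trans i<e (≮⇒≥ j≮e))))
                         (≤-trans (≤-reflexive (+-comm (jump (suc j)) (suc j))) (+jump≤K j+1<s))
      lower : Descent u w → ∃ λ q → q + K < n × Free q × Reach u q
      lower (q , q-free , _ , inj₁ q+K≡u , u⇝q)             = q , subst (_< n) (sym q+K≡u) u<n , q-free , u⇝q
      lower (q , q-free , _ , inj₂ (i , i+1<s , q+K≡w) , u⇝q) = q , subst (_< n) (sym q+K≡w) (Fan.w<n fan i i+1<s) , q-free , u⇝q

    reach-hub-from : ∀ {u q} → q + K < n → Free q → Reach u q → ReachesHub u
    reach-hub-from {q = q} q+K<n q-free u⇝q = by-size (K ≤? q)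
      where
      extend : ReachesHub q → ReachesHub _
      extend (h , H , h-free , q⇝h) = h , H , h-free , reach-trans u⇝q q⇝h
      by-size : Dec (K ≤ q) → ReachesHub _
      by-size (yes K≤q) = q , (K≤q , q+K<n) , q-free , u⇝q
      by-size (no  K≰q) = extend (low-reach-hub (≰⇒> K≰q) q-free)

    reach-hub : ∀ {u} → u < n → Free u → ReachesHub u
    reach-hub {u} u<n u-free = by-height (u + K <? n)
      where
      from-lower : (∃ λ q → q + K < n × Free q × Reach u q) → ReachesHub u
      from-lower (q , q+K<n , q-free , u⇝q) = reach-hub-from q+K<n q-free u⇝q
      by-height : Dec (u + K < n) → ReachesHub u
      by-height (yes u+K<n) = reach-hub-from u+K<n u-free (reach-refl u-free)
      by-height (no  u+K≮n) = from-lower (high-reach-lower u<n (≮⇒≥ u+K≮n) u-free)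

  Back-reflect : ∀ {x y} → Back x y → x < n → Back (reflect y) (reflect x)
  Back-reflect {x} {y} back@(t , t<1+s , 1≤t , x≡y+jt , type) x<n =
    t , t<1+s , 1≤t , +-cancelʳ-≡ (suc y) _ _ ry+1+y≡rx+jt+1+y , reflect-type type
    where
    y<n : y < n
    y<n = <-trans (Back-< back) x<n
    ry+1+y≡rx+jt+1+y : reflect y + suc y ≡ reflect x + jump t + suc y
    ry+1+y≡rx+jt+1+y = begin
      reflect y + suc y              ≡⟨ reflect-+ y<n ⟩
      n                              ≡⟨ sym (reflect-+ x<n) ⟩
      reflect x + suc x              ≡⟨ cong (λ z → reflect x + suc z) x≡y+jt ⟩
      reflect x + suc (y + jump t)   ≡⟨ regroup (reflect x) y (jump t) ⟩
      reflect x + jump t + suc y     ∎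
      where
      open ≡-Reasoning
      regroup : ∀ a y d → a + suc (y + d) ≡ a + d + suc y
      regroup = solve-∀
    reflect-type : t ≡ s ⊎ y < t ⊎ n ≤ x + t → t ≡ s ⊎ reflect x < t ⊎ n ≤ reflect y + t
    reflect-type (inj₁ t≡s)          = inj₁ t≡s
    reflect-type (inj₂ (inj₁ y<t))   = inj₂ (inj₂ (subst (_≤ reflect y + t) (reflect-+ y<n) (+-monoʳ-≤ (reflect y) y<t)))
    reflect-type (inj₂ (inj₂ n≤x+t)) = inj₂ (inj₁ (+-cancelʳ-≤ x (suc (reflect x)) t (begin
      suc (reflect x) + x   ≡⟨ sym (+-suc (reflect x) x) ⟩
      reflect x + suc x     ≡⟨ reflect-+ x<n ⟩
      n                     ≤⟨ n≤x+t ⟩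
      x + t                 ≡⟨ +-comm x t ⟩
      t + x                 ∎)))
      where open ≤-Reasoning

  Arc-reflect : ∀ {a b} → Arc a b → a < n → b < n → Arc (reflect b) (reflect a)
  Arc-reflect (inj₁ (a<b , ¬back)) a<n b<n = inj₁ (reflect-anti a<b b<n ,
    λ back → ¬back (subst₂ Back (reflect-involutive b<n) (reflect-involutive a<n) (Back-reflect back (reflect-< a<n))))
  Arc-reflect (inj₂ (b<a , back)) a<n b<n = inj₂ (reflect-anti b<a a<n , Back-reflect back a<n)

  walk-reflect : ∀ {S x y l} → x < n → y < n →
                 Walk arc (⊤ ─ reflectSubset S) (vertex x) (vertex y) l →
                 Walk arc (⊤ ─ S) (vertex (reflect y)) (vertex (reflect x)) l
  walk-reflect {S} x<n y<n p =
    subst₂ (λ a b → Walk arc (⊤ ─ S) a b _) (opposite-vertex y<n) (opposite-vertex x<n)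
      (walk-reverse opposite opposite∈ opposite-arc p)
    where
    opposite∈ : ∀ {z} → z ∈ ⊤ ─ reflectSubset S → opposite z ∈ ⊤ ─ S
    opposite∈ z∈ = x∈⊤─p⁺ λ oz∈S → x∈⊤─p⁻ z∈ (∈-reflectSubset⁺ oz∈S)
    opposite-arc : ∀ {z w} → arc z w ≡ true → arc (opposite w) (opposite z) ≡ true
    opposite-arc {z} {w} zw = arc⁺ (subst₂ Arc (sym (opposite-prop w)) (sym (opposite-prop z))
                                (Arc-reflect (arc⁻ zw) (toℕ<n z) (toℕ<n w)))

  Hub-reflect : ∀ {h} → Hub h → Hub (reflect h)
  Hub-reflect {h} H@(K≤h , h+K<n) =
    +-cancelʳ-≤ (suc h) K (reflect h) (begin
      K + suc h           ≡⟨ +-suc K h ⟩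
      suc (K + h)         ≡⟨ cong suc (+-comm K h) ⟩
      suc (h + K)         ≤⟨ h+K<n ⟩
      n                   ≡⟨ sym (reflect-+ (Hub⇒< H)) ⟩
      reflect h + suc h   ∎) ,
    subst (reflect h + K <_) (reflect-+ (Hub⇒< H)) (+-monoʳ-< (reflect h) (s≤s K≤h))
    where open ≤-Reasoning

  -- Both endpoints reach a hub avoiding S; for v this is applied to the mirror image of the tournament.
  walk-avoiding : ∀ (S : Subset n) → ∣ S ∣ < s → ∀ u v → u ∉ S → v ∉ S → ∃ λ l → Walk arc (⊤ ─ S) u v l
  walk-avoiding S ∣S∣<s u v u∉S v∉S = connect (A.reach-hub u<n u-free) (A′.reach-hub (reflect-< v<n) rv-free)
    where
    module A  = Avoiding S (small⇒sparse S ∣S∣<s)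
    module A′ = Avoiding (reflectSubset S) (sparse-reflect (small⇒sparse S ∣S∣<s))
    u<n = toℕ<n u
    v<n = toℕ<n v
    u-free : A.Free (toℕ u)
    u-free = subst (_∉ S) (sym (vertex-toℕ u)) u∉S
    v≡rrv : vertex (reflect (reflect (toℕ v))) ≡ v
    v≡rrv = trans (cong vertex (reflect-involutive v<n)) (vertex-toℕ v)
    rv-free : A′.Free (reflect (toℕ v))
    rv-free rv∈ = v∉S (subst (_∈ S) (trans (opposite-vertex (reflect-< v<n)) v≡rrv) (∈-reflectSubset⁻ rv∈))
    connect : A.ReachesHub (toℕ u) → A′.ReachesHub (reflect (toℕ v)) → ∃ λ l → Walk arc (⊤ ─ S) u v l
    connect (h₁ , H₁ , h₁-free , u⇝h₁) (h₂ , H₂ , h₂-free , (l , rv⇝h₂)) =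
      subst₂ (λ a b → ∃ λ l → Walk arc (⊤ ─ S) a b l) (vertex-toℕ u) v≡rrv
        (A.reach-trans (A.reach-trans u⇝h₁ (A.hub-reach H₁ (Hub-reflect H₂) h₁-free rh₂-free)) rh₂⇝v)
      where
      rh₂-free : A.Free (reflect h₂)
      rh₂-free rh₂∈ = h₂-free (∈-reflectSubset⁺ (subst (_∈ S) (sym (opposite-vertex (Hub⇒< H₂))) rh₂∈))
      rh₂⇝v : A.Reach (reflect h₂) (reflect (reflect (toℕ v)))
      rh₂⇝v = l , walk-reflect (reflect-< v<n) (Hub⇒< H₂) rv⇝h₂

  strongly-connected : TStronglyConnected T s
  strongly-connected = subst (suc s ≤_) (sym (∣⊤∣≡n n)) s<n , λ u v S _ _ _ u∉S v∉S ∣S∣<s → walk-avoiding S ∣S∣<s u v u∉S v∉S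
    where
    s<n : s < n
    s<n = ≤-<-trans (m≤n+m s (K + K + s)) K+K+s+s<n

  top-window : ∀ {a t} → a + jump t < n → n ≤ a + jump t + t →
               triangle t < n ∸ (a + s) × n ∸ (a + s) ≤ triangle (suc t)
  top-window {a} {t} below above =
    m+n≤o⇒m≤o∸n (suc (triangle t)) (subst (_≤ n) (regroup₁ a s (triangle t)) below) ,
    m≤n+o⇒m∸n≤o n (a + s) (subst (n ≤_) (regroup₂ a s (triangle t) t) above)
    where
    regroup₁ : ∀ a s x → suc (a + (s + x)) ≡ suc x + (a + s)
    regroup₁ = solve-∀
    regroup₂ : ∀ a s x t → a + (s + x) + t ≡ (a + s) + (t + x)
    regroup₂ = solve-∀

  -- For a ≥ s ∸ 1 a back arc into a is a chain arc or a top arc, and top arcs into a are pinned down by top-window.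
  Back-into-unique : ∀ {x x′ a} → s ≤ suc a → x < n → x′ < n → Back x a → Back x′ a → x ≡ x′
  Back-into-unique {a = a} s≤a+1 x<n x′<n (t , s≤s t≤s , _ , refl , type) (t′ , s≤s t′≤s , _ , refl , type′) =
    cong (λ r → a + jump r) (same (into-type t≤s type) (into-type t′≤s type′))
    where
    into-type : ∀ {t} → t ≤ s → t ≡ s ⊎ a < t ⊎ n ≤ a + jump t + t → t ≡ s ⊎ (t < s × n ≤ a + jump t + t)
    into-type _   (inj₁ t≡s)          = inj₁ t≡s
    into-type t≤s (inj₂ (inj₁ a<t))   = inj₁ (≤-antisym t≤s (≤-trans s≤a+1 a<t))
    into-type t≤s (inj₂ (inj₂ n≤x+t)) with m≤n⇒m<n∨m≡n t≤s
    ... | inj₁ t<s = inj₂ (t<s , n≤x+t)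
    ... | inj₂ t≡s = inj₁ t≡s
    chain-below-top : ∀ {t} → a + K < n → t < s → ¬ n ≤ a + jump t + t
    chain-below-top {t} a+K<n t<s n≤ = <⇒≱ a+K<n (≤-trans n≤ (≤-trans (≤-reflexive (+-assoc a (jump t) t))
                                         (+-monoʳ-≤ a (subst (_≤ K) (+-comm t (jump t)) (+jump≤K t<s)))))
    same : t ≡ s ⊎ (t < s × n ≤ a + jump t + t) → t′ ≡ s ⊎ (t′ < s × n ≤ a + jump t′ + t′) → t ≡ t′
    same (inj₁ t≡s)          (inj₁ t′≡s)           = trans t≡s (sym t′≡s)
    same (inj₁ refl)         (inj₂ (t′<s , top′))  = ⊥-elim (chain-below-top x<n t′<s top′)
    same (inj₂ (t<s , top))  (inj₁ refl)           = ⊥-elim (chain-below-top x′<n t<s top)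
    same (inj₂ (_ , top))    (inj₂ (_ , top′))     =
      triangle-interval-unique (proj₁ (top-window {a} {t} x<n top)) (proj₂ (top-window {a} {t} x<n top))
                               (proj₁ (top-window {a} {t′} x′<n top′)) (proj₂ (top-window {a} {t′} x′<n top′))

  bottom-window : ∀ {y t} → y < t → triangle t < suc (y + triangle t) × suc (y + triangle t) ≤ triangle (suc t)
  bottom-window {y} {t} y<t = s≤s (m≤n+m (triangle t) y) , +-monoˡ-≤ (triangle t) y<t

  -- Dually, for b + s ≤ n a back arc out of b is a chain arc or a bottom arc, pinned down by bottom-window.
  Back-from-unique : ∀ {b y y′} → b + s ≤ n → Back b y → Back b y′ → y ≡ y′
  Back-from-unique {b} {y} {y′} b+s≤n (t , s≤s t≤s , _ , b≡y+jt , type) (t′ , s≤s t′≤s , _ , b≡y′+jt′ , type′) =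
    same (from-type t≤s type) (from-type t′≤s type′)
    where
    y+jt≡y′+jt′ : y + jump t ≡ y′ + jump t′
    y+jt≡y′+jt′ = trans (sym b≡y+jt) b≡y′+jt′
    from-type : ∀ {y t} → t ≤ s → t ≡ s ⊎ y < t ⊎ n ≤ b + t → t ≡ s ⊎ (t < s × y < t)
    from-type _   (inj₁ t≡s)          = inj₁ t≡s
    from-type t≤s (inj₂ (inj₂ n≤b+t)) = inj₁ (≤-antisym t≤s (+-cancelˡ-≤ b s _ (≤-trans b+s≤n n≤b+t)))
    from-type t≤s (inj₂ (inj₁ y<t)) with m≤n⇒m<n∨m≡n t≤s
    ... | inj₁ t<s = inj₂ (t<s , y<t)
    ... | inj₂ t≡s = inj₁ t≡s
    bottom<K : ∀ {y t} → t < s → y < t → y + jump t < K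
    bottom<K {t = t} t<s y<t = ≤-trans (+-monoˡ-≤ (jump t) y<t) (+jump≤K t<s)
    same : t ≡ s ⊎ (t < s × y < t) → t′ ≡ s ⊎ (t′ < s × y′ < t′) → y ≡ y′
    same (inj₁ refl)         (inj₁ refl)            = +-cancelʳ-≡ K y y′ y+jt≡y′+jt′
    same (inj₁ refl)         (inj₂ (t′<s , y′<t′))  =
      ⊥-elim (<⇒≱ (bottom<K t′<s y′<t′) (≤-trans (m≤n+m K y) (≤-reflexive y+jt≡y′+jt′)))
    same (inj₂ (t<s , y<t))  (inj₁ refl)            =
      ⊥-elim (<⇒≱ (bottom<K t<s y<t) (≤-trans (m≤n+m K y′) (≤-reflexive (sym y+jt≡y′+jt′))))
    same (inj₂ (_ , y<t))    (inj₂ (_ , y′<t′))     =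
      +-cancelʳ-≡ (jump t) y y′ (subst (λ r → y + jump t ≡ y′ + jump r) (sym t≡t′) y+jt≡y′+jt′)
      where
      y+Tt≡y′+Tt′ : suc (y + triangle t) ≡ suc (y′ + triangle t′)
      y+Tt≡y′+Tt′ = cong suc (+-cancelˡ-≡ s _ _
        (trans (regroup y s (triangle t)) (trans y+jt≡y′+jt′ (sym (regroup y′ s (triangle t′))))))
        where
        regroup : ∀ y s x → s + (y + x) ≡ y + (s + x)
        regroup = solve-∀
      t≡t′ : t ≡ t′
      t≡t′ = triangle-interval-unique (proj₁ (bottom-window y<t)) (proj₂ (bottom-window y<t))
               (subst (triangle t′ <_) (sym y+Tt≡y′+Tt′) (proj₁ (bottom-window y′<t′)))
               (subst (_≤ triangle (suc t′)) (sym y+Tt≡y′+Tt′) (proj₂ (bottom-window y′<t′)))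

  minimum-low : ∀ {k A} → 2 ≤ k → StronglyConnected arc A k →
                ∀ {a} → a ∈ A → (∀ {y} → y ∈ A → toℕ a ≤ toℕ y) → 2 + toℕ a ≤ s
  minimum-low {A = A} 2≤k A-conn {a} a∈A least = ≰⇒> (distinct (two-in-neighbours T 2≤k A-conn a∈A))
    where
    back-into : ∀ {z} → z ∈ A → arc z a ≡ true → Back (toℕ z) (toℕ a)
    back-into z∈A za with arc⁻ za
    ... | inj₁ (z<a , _)  = ⊥-elim (<⇒≱ z<a (least z∈A))
    ... | inj₂ (_ , back) = back
    distinct : (∃ λ x → ∃ λ y → x ∈ A × y ∈ A × arc x a ≡ true × arc y a ≡ true × x ≢ y) → ¬ s ≤ suc (toℕ a)
    distinct (x , y , x∈A , y∈A , xa , ya , x≢y) s≤a+1 =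
      x≢y (toℕ-injective (Back-into-unique s≤a+1 (toℕ<n x) (toℕ<n y) (back-into x∈A xa) (back-into y∈A ya)))

  maximum-high : ∀ {k A} → 2 ≤ k → StronglyConnected arc A k →
                 ∀ {b} → b ∈ A → (∀ {y} → y ∈ A → toℕ y ≤ toℕ b) → n < toℕ b + s
  maximum-high {A = A} 2≤k A-conn {b} b∈A greatest = ≰⇒> (distinct (two-out-neighbours T 2≤k A-conn b∈A))
    where
    back-from : ∀ {z} → z ∈ A → arc b z ≡ true → Back (toℕ b) (toℕ z)
    back-from z∈A bz with arc⁻ bz
    ... | inj₁ (b<z , _)  = ⊥-elim (<⇒≱ b<z (greatest z∈A))
    ... | inj₂ (_ , back) = back
    distinct : (∃ λ x → ∃ λ y → x ∈ A × y ∈ A × arc b x ≡ true × arc b y ≡ true × x ≢ y) → ¬ toℕ b + s ≤ n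
    distinct (x , y , x∈A , y∈A , bx , by , x≢y) b+s≤n =
      x≢y (toℕ-injective (Back-from-unique b+s≤n (back-from x∈A bx) (back-from y∈A by)))

  s*s≤K+K : s * s ≤ K + K
  s*s≤K+K = begin
    s * s                              ≡⟨ sym (triangle-double s) ⟩
    triangle s + triangle s + s        ≤⟨ m≤m+n _ s ⟩
    triangle s + triangle s + s + s    ≡⟨ regroup s (triangle s) ⟩
    K + K                              ∎
    where
    open ≤-Reasoning
    regroup : ∀ s x → x + x + s + s ≡ s + x + (s + x)
    regroup = solve-∀

  -- A has two vertices a ≤ s ∸ 2 and b > n ∸ s, and at least k vertices in each of the
  -- m = ⌊(n ∸ (s + s ∸ 2)) / K⌋ consecutive windows of length K starting at s ∸ 2.
  subtournament-bound : ∀ {k} → 2 ≤ k → k ≤ s → ∀ A → StronglyConnected arc A k → k * n ≤ K * (∣ A ∣ + k + 2)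
  subtournament-bound {k} 2≤k k≤s A A-conn = begin
    k * n                               ≤⟨ *-monoʳ-≤ k n≤ ⟩
    k * (s + s′ + (m * K + K))          ≡⟨ *-distribˡ-+ k (s + s′) (m * K + K) ⟩
    k * (s + s′) + k * (m * K + K)      ≤⟨ +-monoˡ-≤ (k * (m * K + K)) k[s+s′]≤4K ⟩
    K + K + K + K + k * (m * K + K)     ≡⟨ regroup k m K ⟩
    K * (k * m + 2 + k + 2)             ≤⟨ *-monoʳ-≤ K (+-monoˡ-≤ 2 (+-monoˡ-≤ k km+2≤∣A∣)) ⟩
    K * (∣ A ∣ + k + 2)                 ∎
    where
    open ≤-Reasoning
    regroup : ∀ k m K → K + K + K + K + k * (m * K + K) ≡ K * (k * m + 2 + k + 2)
    regroup = solve-∀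
    1≤∣A∣ : 1 ≤ ∣ A ∣
    1≤∣A∣ = ≤-trans (s≤s z≤n) (proj₁ A-conn)
    a = proj₁ (minimum A 1≤∣A∣)
    a∈A = proj₁ (proj₂ (minimum A 1≤∣A∣))
    b = proj₁ (maximum A 1≤∣A∣)
    b∈A = proj₁ (proj₂ (maximum A 1≤∣A∣))
    s′ = s ∸ 2
    a≤s′ : toℕ a ≤ s′
    a≤s′ = m+n≤o⇒m≤o∸n (toℕ a) (subst (_≤ s) (+-comm 2 (toℕ a))
             (minimum-low 2≤k A-conn a∈A (proj₂ (proj₂ (minimum A 1≤∣A∣)))))
    n<b+s : n < toℕ b + s
    n<b+s = maximum-high 2≤k A-conn b∈A (proj₂ (proj₂ (maximum A 1≤∣A∣)))
    X = n ∸ (s + s′)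
    s+s′+X≡n : s + s′ + X ≡ n
    s+s′+X≡n = m+[n∸m]≡n (begin
      s + s′            ≤⟨ +-monoʳ-≤ s (m∸n≤m s 2) ⟩
      s + s             ≤⟨ m≤n+m (s + s) (K + K) ⟩
      K + K + (s + s)   ≡⟨ sym (+-assoc (K + K) s s) ⟩
      K + K + s + s     ≤⟨ <⇒≤ K+K+s+s<n ⟩
      n                 ∎)
    instance
      K-nonZero : NonZero K
      K-nonZero = >-nonZero 1≤K
    m = X / K
    X<mK+K : X < m * K + K
    X<mK+K = begin-strict
      X                 ≡⟨ m≡m%n+[m/n]*n X K ⟩
      X % K + m * K     <⟨ +-monoˡ-< (m * K) (m%n<n X K) ⟩
      K + m * K         ≡⟨ +-comm K (m * K) ⟩
      m * K + K         ∎
    n≤ : n ≤ s + s′ + (m * K + K)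
    n≤ = subst (_≤ s + s′ + (m * K + K)) s+s′+X≡n (+-monoʳ-≤ (s + s′) (<⇒≤ X<mK+K))
    s′+mK<b : s′ + m * K < toℕ b
    s′+mK<b = ≤-<-trans (+-monoʳ-≤ s′ (m/n*n≤m X K)) (+-cancelˡ-< s (s′ + X) (toℕ b)
                (subst₂ _<_ (trans (sym s+s′+X≡n) (+-assoc s s′ X)) (+-comm (toℕ b) s) n<b+s))
    Q = A ∩ interval s′ (s′ + m * K)
    km+2≤∣A∣ : k * m + 2 ≤ ∣ A ∣
    km+2≤∣A∣ = ≤-trans (+-monoˡ-≤ 2 (windows-count K (Arc-≤+K ∘ arc⁻) A-conn a∈A b∈A s′ m a≤s′ s′+mK<b))
                 (∣p∣+2≤∣r∣ (p∩q⊆p A _) a∈A b∈A a∉Q b∉Q a≢b)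
      where
      a∉Q : a ∉ Q
      a∉Q a∈Q = <⇒≱ (proj₁ (∈-interval⁻ (proj₂ (x∈p∩q⁻ A _ a∈Q)))) a≤s′
      b∉Q : b ∉ Q
      b∉Q b∈Q = <⇒≱ s′+mK<b (proj₂ (∈-interval⁻ (proj₂ (x∈p∩q⁻ A _ b∈Q))))
      a≢b : a ≢ b
      a≢b a≡b = <⇒≱ (≤-<-trans (m≤m+n s′ (m * K)) s′+mK<b) (subst (λ x → toℕ x ≤ s′) a≡b a≤s′)
    k[s+s′]≤4K : k * (s + s′) ≤ K + K + K + K
    k[s+s′]≤4K = begin
      k * (s + s′)          ≤⟨ *-mono-≤ k≤s (+-monoʳ-≤ s (m∸n≤m s 2)) ⟩
      s * (s + s)           ≡⟨ *-distribˡ-+ s s s ⟩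
      s * s + s * s         ≤⟨ +-mono-≤ s*s≤K+K s*s≤K+K ⟩
      K + K + (K + K)       ≡⟨ sym (+-assoc (K + K) K K) ⟩
      K + K + K + K         ∎

proposition1p2 : ∀ (k s n : ℕ) → 2 ≤ k → k ≤ s →
    2 * (suc s C 2) + 2 * s + 2 ≤ n →
    Σ (Tournament n) λ T →
      TStronglyConnected T s ×
      (Σ ℕ λ d → DiameterAtLeast T d × n ∸ 2 * s ≤ (suc s C 2) * d) ×
      (∀ (A : Subset n) → StronglyConnected (edge T) A k →
         k * n ≤ (suc s C 2) * (∣ A ∣ + k + 2))
proposition1p2 k s n 2≤k k≤s large =
  T , strongly-connected ,
  subst (λ c → ∃ λ d → DiameterAtLeast T d × n ∸ 2 * s ≤ c * d) (sym C≡K) diameter-large ,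
  λ A A-conn → subst (λ c → k * n ≤ c * (∣ A ∣ + k + 2)) (sym C≡K) (subtournament-bound 2≤k k≤s A A-conn)
  where
  C≡K : suc s C 2 ≡ s + triangle s
  C≡K = nC2≡triangle (suc s)
  open Construction s n (≤-trans 2≤k k≤s) (subst (λ c → 2 * c + 2 * s + 2 ≤ n) C≡K large)
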